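{- A $4 \times n$ rectangle ($n \ge 1$) can be tiled by $T$ tetrominoes only if $n$ is a multiple of $4$. For integers $t \ge 0$, the number $N(t)$ of tilings of the $4 \times 4t$ rectangle by $T$ tetrominoes satisfies $N(0)=1$ and $N(t) = 2 \cdot 3^{t-1}$ for $t \ge 1$; equivalently $\sum_{t\ge 0} N(t) z^t = \frac{1-z}{1-3z}$. Moreover, for every $t \ge 1$ there are exactly two fault-free tilings of the $4 \times 4t$ rectangle by $T$ tetrominoes.
   Context: The $T$ tetromino is the polyomino with cells $(0,0),(1,0),(2,0),(1,1)$. A tiling of a region by a polyomino is a partition of its unit cells into copies of the polyomino, where copies may be translated, rotated and reflected. A $4 \times n$ rectangle has 4 rows and $n$ columns, occupying $[0,n]\times[0,4]$. A tiling of it is fault-free if there is no integer $k$ with $0<k<n$ such that every tile lies entirely in $x \le k$ or entirely in $x \ge k$. -}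

module Defs where

open import Data.Bool using (Bool; true; false; if_then_else_)
open import Data.Nat as ℕ using (ℕ; zero; suc; _*_; _^_; _<_; _≤_)
open import Data.Integer as ℤ using (ℤ; +_; -_)
open import Data.Fin using (Fin; toℕ)
open import Data.Vec using (Vec; lookup)
open import Data.List using (List; []; _∷_; map; length)
open import Data.List.Membership.Propositional using (_∈_)
open import Data.List.Relation.Unary.All using (All)
open import Data.List.Relation.Unary.Unique.Propositional using (Unique)
open import Data.Product using (Σ; ∃; _×_; _,_)
open import Data.Sum using (_⊎_)
open import Relation.Binary.PropositionalEquality using (_≡_)
open import Relation.Nullary using (¬_)
open import Function.Bundles using (_⇔_)

-- Integer points of the plane; a unit cell is named by its lower-left corner.
Point : Set
Point = ℤ × ℤ

Tcells : List Point
Tcells = (+ 0 , + 0) ∷ (+ 1 , + 0) ∷ (+ 2 , + 0) ∷ (+ 1 , + 1) ∷ []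

-- The 8 symmetries of the square lattice fixing the origin, as they act on
-- unit cells named by lower-left corners:
--   optional swap of coordinates, then optional reflection x ↦ -1-x, y ↦ -1-y
-- (reflecting the cell [x,x+1] in the line x=0 gives [-x-1,-x]).
-- Combined with arbitrary integer translations these give all placements
-- of a polyomino by rotations, reflections and translations.
flipC : Bool → ℤ → ℤ
flipC false x = x
flipC true  x = ℤ.-[1+ 0 ] ℤ.- x

symCell : Bool → Bool → Bool → Point → Point
symCell sw fx fy (x , y) =
  if sw then (flipC fx y , flipC fy x) else (flipC fx x , flipC fy y)

placeT : Bool → Bool → Bool → ℤ → ℤ → List Point
placeT sw fx fy a b = map (λ p → let (x , y) = symCell sw fx fy p in (a ℤ.+ x , b ℤ.+ y)) Tcells

-- A subset of the cells of the 4 × n rectangle: cell (i , j) is the unit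
-- square [i,i+1] × [j,j+1], i < n (column), j < 4 (row).
Region : ℕ → Set
Region n = Vec (Vec Bool 4) n

_∋_ : ∀ {n} → Region n → Fin n × Fin 4 → Set
R ∋ (i , j) = lookup (lookup R i) j ≡ true

InRect : ℕ → Point → Set
InRect n (x , y) = Σ ℕ λ i → Σ ℕ λ j → (x ≡ + i) × (y ≡ + j) × (i < n) × (j < 4)

IsTCopy : ∀ {n} → Region n → Set
IsTCopy {n} R =
  Σ Bool λ sw → Σ Bool λ fx → Σ Bool λ fy → Σ ℤ λ a → Σ ℤ λ b →
    All (InRect n) (placeT sw fx fy a b) ×
    (∀ (i : Fin n) (j : Fin 4) → (R ∋ (i , j)) ⇔ ((+ toℕ i , + toℕ j) ∈ placeT sw fx fy a b))

-- A partition of the cells of the rectangle is encoded (bijectively) by the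
-- map sending each cell to the block (tile) containing it.
TileMap : ℕ → Set
TileMap n = Vec (Vec (Region n) 4) n

tileAt : ∀ {n} → TileMap n → Fin n → Fin 4 → Region n
tileAt m i j = lookup (lookup m i) j

IsTiling : (n : ℕ) → TileMap n → Set
IsTiling n m = ∀ (i : Fin n) (j : Fin 4) →
  (tileAt m i j ∋ (i , j)) ×
  IsTCopy (tileAt m i j) ×
  (∀ (i' : Fin n) (j' : Fin 4) → tileAt m i j ∋ (i' , j') → tileAt m i' j' ≡ tileAt m i j)

Tileable : ℕ → Set
Tileable n = ∃ λ (m : TileMap n) → IsTiling n m

-- Fault at the line x = k: every tile lies entirely in x ≤ k or entirely in x ≥ k.
-- (cell (i,j) lies in x ≤ k iff i+1 ≤ k, and in x ≥ k iff k ≤ i).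
FaultAt : ∀ {n} → TileMap n → ℕ → Set
FaultAt {n} m k = ∀ (i : Fin n) (j : Fin 4) →
  (∀ i' j' → tileAt m i j ∋ (i' , j') → toℕ i' < k) ⊎
  (∀ i' j' → tileAt m i j ∋ (i' , j') → k ≤ toℕ i')

FaultFree : ∀ {n} → TileMap n → Set
FaultFree {n} m = ¬ (Σ ℕ λ k → (0 < k) × (k < n) × FaultAt m k)

HasCount : {A : Set} → (A → Set) → ℕ → Set
HasCount {A} P k = Σ (List A) λ L →
  (length L ≡ k) × Unique L × All P L × (∀ x → P x → x ∈ L)

Nclosed : ℕ → ℕ
Nclosed zero = 1
Nclosed (suc t) = 2 * 3 ^ t

-- A tiling is read column by column.  In the current column the lowest uncovered cell
-- must be covered by a tile whose leftmost column is the current one, and all that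
-- matters about the tiles placed so far is which cells of the next three columns they
-- cover (the window).  So tilings are in bijection with the leaves of a deterministic
-- search tree, and counting tilings is counting leaves.  Evaluating the search, the
-- first column leaves one of two windows s₁, s₂, and four columns later the search is
-- again in the same window, having possibly closed a block at a multiple of 4.  Hence
-- N(t + 1) = 3 N(t) for t ≥ 1 (continue, or close the block and restart), while without
-- faults only the two periodic branches survive; lengths n ≢ 0 (mod 4) admit no tiling.

module Submission where

open import Defs
open import Data.Bool using (Bool; true; false; if_then_else_; _∧_; _∨_; not)
open import Data.Bool.Properties using (T-≡; ∨-zeroʳ; ∧-identityʳ)
open import Data.Bool.ListAction using (any)
open import Data.Empty using (⊥; ⊥-elim)
open import Data.Fin using (Fin; toℕ; fromℕ<)
open import Data.Fin.Properties using (toℕ<n; toℕ-fromℕ<)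
open import Data.Integer as ℤ using (ℤ; +_)
import Data.Integer.Properties as ℤₚ
open import Data.List using (List; []; _∷_; map; concatMap; length; _++_)
open import Data.List.Properties using (map-∘; map-cong; length-++; length-map)
open import Data.List.Membership.Propositional using (_∈_; find; lose)
open import Data.List.Membership.Propositional.Properties using (∈-map⁺; ∈-map⁻; ∈-concatMap⁺; ∈-concatMap⁻)
open import Data.List.Relation.Unary.Any using (Any; here; there)
open import Data.List.Relation.Unary.All as All using (All; []; _∷_)
import Data.List.Relation.Unary.All.Properties as All
open import Data.List.Relation.Unary.AllPairs as AllPairs using (AllPairs; []; _∷_)
import Data.List.Relation.Unary.AllPairs.Properties as AllPairs
open import Data.List.Relation.Binary.Permutation.Propositional using (_↭_; ↭-refl; ↭-sym; ↭-trans; ↭-swap; ↭-prep; ↭-reflexive)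
import Data.List.Relation.Binary.Permutation.Propositional.Properties as ↭
open import Data.Nat as ℕ using (ℕ; zero; suc; _+_; _*_; _^_; _∸_; _<_; _≤_; z≤n; s≤s; _≡ᵇ_; _<ᵇ_; _≤ᵇ_)
import Data.Nat.Properties as ℕₚ
open import Data.Nat.Divisibility using (_∣_; divides)
open import Data.Product using (Σ; ∃; ∃₂; _×_; _,_; proj₁; proj₂)
open import Data.Sum using (_⊎_; inj₁; inj₂)
open import Data.Vec as Vec using (Vec; []; _∷_; lookup; tabulate)
open import Data.Vec.Properties using (lookup∘tabulate; tabulate∘lookup; tabulate-cong)
open import Function.Bundles using (_⇔_; mk⇔; Equivalence)
open import Function.Construct.Composition using (_⇔-∘_)
open import Function.Construct.Symmetry using (⇔-sym)
open import Relation.Binary.PropositionalEquality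
open import Relation.Nullary using (¬_)
open import Algebra.Properties.CommutativeSemigroup ℕₚ.+-commutativeSemigroup using (interchange)

true≢false : true ≢ false
true≢false ()

∨-false⁻ : ∀ {a b} → (a ∨ b) ≡ false → a ≡ false × b ≡ false
∨-false⁻ {false} {false} _ = refl , refl

∨-true⁻ : ∀ {a b} → (a ∨ b) ≡ true → a ≡ true ⊎ b ≡ true
∨-true⁻ {true}  _ = inj₁ refl
∨-true⁻ {false} e = inj₂ e

∧-true⁻ : ∀ {a b} → (a ∧ b) ≡ true → a ≡ true × b ≡ true
∧-true⁻ {true} {true} _ = refl , refl

m<n⇒m<ᵇn : ∀ m n → m < n → (m <ᵇ n) ≡ true
m<n⇒m<ᵇn zero    (suc n) _       = refl
m<n⇒m<ᵇn (suc m) (suc n) (s≤s p) = m<n⇒m<ᵇn m n p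

n≤m⇒m≮ᵇn : ∀ m n → n ≤ m → (m <ᵇ n) ≡ false
n≤m⇒m≮ᵇn m       zero    _       = refl
n≤m⇒m≮ᵇn (suc m) (suc n) (s≤s p) = n≤m⇒m≮ᵇn m n p

m<ᵇn⇒m<n : ∀ m n → (m <ᵇ n) ≡ true → m < n
m<ᵇn⇒m<n zero    (suc n) _ = s≤s z≤n
m<ᵇn⇒m<n (suc m) (suc n) e = s≤s (m<ᵇn⇒m<n m n e)

m≤ᵇn⇒m≤n : ∀ m n → (m ≤ᵇ n) ≡ true → m ≤ n
m≤ᵇn⇒m≤n zero    n _ = z≤n
m≤ᵇn⇒m≤n (suc m) n e = m<ᵇn⇒m<n m n e

m≤n⇒m≤ᵇn : ∀ m n → m ≤ n → (m ≤ᵇ n) ≡ true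
m≤n⇒m≤ᵇn zero    n _ = refl
m≤n⇒m≤ᵇn (suc m) n p = m<n⇒m<ᵇn m n p

≡ᵇ-cancelˡ-+ : ∀ x k p → ((x + k) ≡ᵇ (x + p)) ≡ (k ≡ᵇ p)
≡ᵇ-cancelˡ-+ zero    k p = refl
≡ᵇ-cancelˡ-+ (suc x) k p = ≡ᵇ-cancelˡ-+ x k p

m<n⇒m≢ᵇn : ∀ m n → m < n → (m ≡ᵇ n) ≡ false
m<n⇒m≢ᵇn zero    (suc n) _       = refl
m<n⇒m≢ᵇn (suc m) (suc n) (s≤s p) = m<n⇒m≢ᵇn m n p

below-or-offset : ∀ x i → (i < x) ⊎ (∃ λ k → i ≡ x + k)
below-or-offset x i with ℕₚ.<-≤-connex i x
... | inj₁ p = inj₁ p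
... | inj₂ p = inj₂ (i ∸ x , sym (ℕₚ.m+[n∸m]≡n p))

vec-ext : ∀ {A : Set} {k} {u v : Vec A k} → (∀ i → lookup u i ≡ lookup v i) → u ≡ v
vec-ext {u = u} {v} h = trans (sym (tabulate∘lookup u)) (trans (tabulate-cong h) (tabulate∘lookup v))

bool-ext : ∀ {a b : Bool} → a ≡ true ⇔ b ≡ true → a ≡ b
bool-ext {true}  a⇔b = sym (Equivalence.to a⇔b refl)
bool-ext {false} {true}  a⇔b = Equivalence.from a⇔b refl
bool-ext {false} {false} _   = refl

∈-resp-↭⇔ : ∀ {A : Set} {x : A} {xs ys} → xs ↭ ys → x ∈ xs ⇔ x ∈ ys
∈-resp-↭⇔ p = mk⇔ (↭.∈-resp-↭ p) (↭.∈-resp-↭ (↭-sym p))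

minus-plus : ∀ a b → a ℤ.- b ℤ.+ b ≡ a
minus-plus a b = trans (ℤₚ.+-assoc a (ℤ.- b) b) (trans (cong (λ x → a ℤ.+ x) (ℤₚ.+-inverseˡ b)) (ℤₚ.+-identityʳ a))

-- Unlike sum ∘ map, no trailing + 0 appears, so that the recurrences below hold by refl.
sumMap : ∀ {A : Set} → (A → ℕ) → List A → ℕ
sumMap f []                = 0
sumMap f (c ∷ [])          = f c
sumMap f (c ∷ cs@(_ ∷ _))  = f c + sumMap f cs

length-concatMap : ∀ {A B : Set} (f : A → List B) (g : A → ℕ) → (∀ a → length (f a) ≡ g a) →
  ∀ as → length (concatMap f as) ≡ sumMap g as
length-concatMap f g h []               = refl
length-concatMap f g h (a ∷ [])         = trans (length-++ (f a)) (trans (ℕₚ.+-identityʳ _) (h a))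
length-concatMap f g h (a ∷ as@(_ ∷ _)) = trans (length-++ (f a)) (cong₂ _+_ (h a) (length-concatMap f g h as))

allPairs-concatMap : ∀ {A B : Set} {R : B → B → Set} (f : A → List B) xs → (∀ x → x ∈ xs → AllPairs R (f x)) →
  AllPairs (λ x y → ∀ {u v} → u ∈ f x → v ∈ f y → R u v) xs → AllPairs R (concatMap f xs)
allPairs-concatMap f [] _ _ = []
allPairs-concatMap f (x ∷ xs) h (a ∷ ap) = AllPairs.++⁺ (h x (here refl)) (allPairs-concatMap f xs (λ y m → h y (there m)) ap)
  (All.tabulate (λ {u} u∈ → All.tabulate (λ {v} v∈ → let (y , y∈ , v∈') = find (∈-concatMap⁻ f v∈) in All.lookup a y∈ u∈ v∈')))

hasCount-resp : ∀ {A : Set} {P Q : A → Set} {k} → (∀ a → P a ⇔ Q a) → HasCount P k → HasCount Q k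
hasCount-resp P⇔Q (as , length≡k , unique , all-P , complete) =
  as , length≡k , unique , All.map (Equivalence.to (P⇔Q _)) all-P , λ a q → complete a (Equivalence.from (P⇔Q a) q)

hasCount-zero : ∀ {A : Set} {P : A → Set} {a} → HasCount P 0 → ¬ P a
hasCount-zero ([] , _ , _ , _ , complete) p with complete _ p
... | ()

-- Placed copies of the T tetromino

data Orientation : Set where
  up down right left : Orientation

offsets : Orientation → List (ℕ × ℕ)
offsets up    = (0 , 0) ∷ (1 , 0) ∷ (2 , 0) ∷ (1 , 1) ∷ []
offsets down  = (0 , 1) ∷ (1 , 1) ∷ (2 , 1) ∷ (1 , 0) ∷ []
offsets right = (0 , 0) ∷ (0 , 1) ∷ (0 , 2) ∷ (1 , 1) ∷ []
offsets left  = (1 , 0) ∷ (1 , 1) ∷ (1 , 2) ∷ (0 , 1) ∷ []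

width height : Orientation → ℕ
width up    = 3
width down  = 3
width right = 2
width left  = 2
height up    = 2
height down  = 2
height right = 3
height left  = 3

Placement : Set
Placement = Orientation × ℕ × ℕ

cells : Placement → List (ℕ × ℕ)
cells (o , X , Y) = map (λ pq → (X + proj₁ pq , Y + proj₂ pq)) (offsets o)

hasCell : Placement → ℕ → ℕ → Bool
hasCell d i j = any (λ c → (i ≡ᵇ proj₁ c) ∧ (j ≡ᵇ proj₂ c)) (cells d)

any-≡ᵇ⇔∈ : ∀ i j l → any (λ c → (i ≡ᵇ proj₁ c) ∧ (j ≡ᵇ proj₂ c)) l ≡ true ⇔ (i , j) ∈ l
any-≡ᵇ⇔∈ i j l = mk⇔ (to l) (from l)
  where
  to : ∀ l → any (λ c → (i ≡ᵇ proj₁ c) ∧ (j ≡ᵇ proj₂ c)) l ≡ true → (i , j) ∈ l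
  to ((a , b) ∷ l) e with i ≡ᵇ a in i≡a | j ≡ᵇ b in j≡b
  ... | true  | true  = here (cong₂ _,_ (ℕₚ.≡ᵇ⇒≡ i a (Equivalence.from T-≡ i≡a)) (ℕₚ.≡ᵇ⇒≡ j b (Equivalence.from T-≡ j≡b)))
  ... | true  | false = there (to l e)
  ... | false | _     = there (to l e)
  from : ∀ l → (i , j) ∈ l → any (λ c → (i ≡ᵇ proj₁ c) ∧ (j ≡ᵇ proj₂ c)) l ≡ true
  from (_ ∷ _) (here refl)
    rewrite Equivalence.to T-≡ (ℕₚ.≡⇒≡ᵇ i i refl) | Equivalence.to T-≡ (ℕₚ.≡⇒≡ᵇ j j refl) = refl
  from (c ∷ l) (there p) rewrite from l p = ∨-zeroʳ _

hasCell⇔ : ∀ d i j → hasCell d i j ≡ true ⇔ (i , j) ∈ cells d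
hasCell⇔ d i j = any-≡ᵇ⇔∈ i j (cells d)

toPoint : ℕ × ℕ → Point
toPoint (i , j) = (+ i , + j)

translate : ℤ → ℤ → Point → Point
translate a b (x , y) = (a ℤ.+ x , b ℤ.+ y)

orientation : Bool → Bool → Bool → Orientation
orientation false _     false = up
orientation false _     true  = down
orientation true  false _     = right
orientation true  true  _     = left

originX originY : Bool → Bool → Bool → ℤ
originX sw fx fy = if fx then + width (orientation sw fx fy) else + 0
originY sw fx fy = if fy then + height (orientation sw fx fy) else + 0

swap₁₃ : ∀ {A : Set} (a b c d : A) → c ∷ b ∷ a ∷ d ∷ [] ↭ a ∷ b ∷ c ∷ d ∷ []
swap₁₃ a b c d = ↭-trans (↭-swap c b ↭-refl) (↭-trans (↭-prep b (↭-swap c a ↭-refl)) (↭-swap b a ↭-refl))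

placeT-origin : ∀ sw fx fy →
  placeT sw fx fy (originX sw fx fy) (originY sw fx fy) ↭ map toPoint (cells (orientation sw fx fy , 0 , 0))
placeT-origin false false false = ↭-refl
placeT-origin false false true  = ↭-refl
placeT-origin false true  false = swap₁₃ _ _ _ _
placeT-origin false true  true  = swap₁₃ _ _ _ _
placeT-origin true  false false = ↭-refl
placeT-origin true  false true  = swap₁₃ _ _ _ _
placeT-origin true  true  false = ↭-refl
placeT-origin true  true  true  = swap₁₃ _ _ _ _

placeT-translate : ∀ sw fx fy a b c d →
  placeT sw fx fy (a ℤ.+ c) (b ℤ.+ d) ≡ map (translate a b) (placeT sw fx fy c d)
placeT-translate sw fx fy a b c d = trans
  (map-cong {g = λ p → translate a b (translate c d (symCell sw fx fy p))} (λ p → cong₂ _,_ (ℤₚ.+-assoc a c _) (ℤₚ.+-assoc b d _)) Tcells)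
  (map-∘ {g = translate a b} {f = λ p → translate c d (symCell sw fx fy p)} Tcells)

translate-cells : ∀ o X Y → map (translate (+ X) (+ Y)) (map toPoint (cells (o , 0 , 0))) ≡ map toPoint (cells (o , X , Y))
translate-cells up    X Y = refl
translate-cells down  X Y = refl
translate-cells right X Y = refl
translate-cells left  X Y = refl

placeT-translated-origin : ∀ sw fx fy a b →
  placeT sw fx fy a b ↭
  map (translate (a ℤ.- originX sw fx fy) (b ℤ.- originY sw fx fy)) (map toPoint (cells (orientation sw fx fy , 0 , 0)))
placeT-translated-origin sw fx fy a b = ↭-trans (↭-reflexive (trans
  (sym (cong₂ (placeT sw fx fy) (minus-plus a (originX sw fx fy)) (minus-plus b (originY sw fx fy))))
  (placeT-translate sw fx fy (a ℤ.- originX sw fx fy) (b ℤ.- originY sw fx fy) (originX sw fx fy) (originY sw fx fy)))) (↭.map⁺ (translate (a ℤ.- originX sw fx fy) (b ℤ.- originY sw fx fy)) (placeT-origin sw fx fy))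

Fits : ℕ → Placement → Set
Fits n (o , X , Y) = (X + width o ≤ n) × (Y + height o ≤ 4)

private
  corner : ∀ {a i} → a ℤ.+ + 0 ≡ + i → a ≡ + i
  corner {a} e = trans (sym (ℤₚ.+-identityʳ a)) e

  farEdge : ∀ {X p i m} → + X ℤ.+ + p ≡ + i → i < m → X + suc p ≤ m
  farEdge {X} {p} {m = m} e i<m =
    subst (_≤ m) (sym (ℕₚ.+-suc X p)) (subst (_< m) (sym (ℤₚ.+-injective e)) i<m)

inRect-anchor : ∀ {n} o a b → All (InRect n) (map (translate a b) (map toPoint (cells (o , 0 , 0)))) →
  ∃₂ λ X Y → a ≡ + X × b ≡ + Y × Fits n (o , X , Y)
inRect-anchor up a b ((i , j , x₁ , y₁ , _) ∷ _ ∷ (_ , _ , x₃ , _ , i₃<n , _) ∷ (_ , _ , _ , y₄ , _ , j₄<4) ∷ [])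
  with corner {a} x₁ | corner {b} y₁
... | refl | refl = i , j , refl , refl , farEdge x₃ i₃<n , farEdge y₄ j₄<4
inRect-anchor down a b ((i , _ , x₁ , y₁ , _ , j₁<4) ∷ _ ∷ (_ , _ , x₃ , _ , i₃<n , _) ∷ (_ , j , _ , y₄ , _) ∷ [])
  with corner {a} x₁ | corner {b} y₄
... | refl | refl = i , j , refl , refl , farEdge x₃ i₃<n , farEdge y₁ j₁<4
inRect-anchor right a b ((i , j , x₁ , y₁ , _) ∷ _ ∷ (_ , _ , _ , y₃ , _ , j₃<4) ∷ (_ , _ , x₄ , _ , i₄<n , _) ∷ [])
  with corner {a} x₁ | corner {b} y₁
... | refl | refl = i , j , refl , refl , farEdge x₄ i₄<n , farEdge y₃ j₃<4
inRect-anchor left a b ((_ , j , x₁ , y₁ , i₁<n , _) ∷ _ ∷ (_ , _ , _ , y₃ , _ , j₃<4) ∷ (i , _ , x₄ , _) ∷ [])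
  with corner {a} x₄ | corner {b} y₁
... | refl | refl = i , j , refl , refl , farEdge x₁ i₁<n , farEdge y₃ j₃<4

region : ∀ {n} → Placement → Region n
region d = tabulate (λ i → tabulate (λ j → hasCell d (toℕ i) (toℕ j)))

lookup-region : ∀ {n} d (i : Fin n) (j : Fin 4) → lookup (lookup (region d) i) j ≡ hasCell d (toℕ i) (toℕ j)
lookup-region d i j = trans (cong (λ v → lookup v j) (lookup∘tabulate (λ i → tabulate (λ j → hasCell d (toℕ i) (toℕ j))) i))
  (lookup∘tabulate (λ j → hasCell d (toℕ i) (toℕ j)) j)

region-ext : ∀ {n} {R R′ : Region n} → (∀ i j → R ∋ (i , j) ⇔ R′ ∋ (i , j)) → R ≡ R′
region-ext h = vec-ext λ i → vec-ext λ j → bool-ext (h i j)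

offsets-inBox : ∀ o → All (λ pq → proj₁ pq < width o × proj₂ pq < height o) (offsets o)
offsets-inBox up    = (s≤s z≤n , s≤s z≤n) ∷ (s≤s (s≤s z≤n) , s≤s z≤n) ∷ (s≤s (s≤s (s≤s z≤n)) , s≤s z≤n) ∷ (s≤s (s≤s z≤n) , s≤s (s≤s z≤n)) ∷ []
offsets-inBox down  = (s≤s z≤n , s≤s (s≤s z≤n)) ∷ (s≤s (s≤s z≤n) , s≤s (s≤s z≤n)) ∷ (s≤s (s≤s (s≤s z≤n)) , s≤s (s≤s z≤n)) ∷ (s≤s (s≤s z≤n) , s≤s z≤n) ∷ []
offsets-inBox right = (s≤s z≤n , s≤s z≤n) ∷ (s≤s z≤n , s≤s (s≤s z≤n)) ∷ (s≤s z≤n , s≤s (s≤s (s≤s z≤n))) ∷ (s≤s (s≤s z≤n) , s≤s (s≤s z≤n)) ∷ []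
offsets-inBox left  = (s≤s (s≤s z≤n) , s≤s z≤n) ∷ (s≤s (s≤s z≤n) , s≤s (s≤s z≤n)) ∷ (s≤s (s≤s z≤n) , s≤s (s≤s (s≤s z≤n))) ∷ (s≤s z≤n , s≤s (s≤s z≤n)) ∷ []

firstColumnRow : Orientation → ℕ
firstColumnRow up    = 0
firstColumnRow down  = 1
firstColumnRow right = 0
firstColumnRow left  = 1

firstColumnRow∈ : ∀ o → (0 , firstColumnRow o) ∈ offsets o
firstColumnRow∈ up    = here refl
firstColumnRow∈ down  = here refl
firstColumnRow∈ right = here refl
firstColumnRow∈ left  = there (there (there (here refl)))

cells-inRect : ∀ {n} d → Fits n d → All (λ c → proj₁ c < n × proj₂ c < 4) (cells d)
cells-inRect {n} (o , X , Y) (X+w≤n , Y+h≤4) = All.map⁺ (All.map shift (offsets-inBox o))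
  where
  shift : ∀ {pq} → proj₁ pq < width o × proj₂ pq < height o → X + proj₁ pq < n × Y + proj₂ pq < 4
  shift (p<w , q<h) = ℕₚ.<-≤-trans (ℕₚ.+-monoʳ-< X p<w) X+w≤n , ℕₚ.<-≤-trans (ℕₚ.+-monoʳ-< Y q<h) Y+h≤4

hasCell-+ˣ : ∀ o x Y k j → hasCell (o , x , Y) (x + k) j ≡ hasCell (o , 0 , Y) k j
hasCell-+ˣ o x Y k j = go (offsets o)
  where
  go : ∀ l → any (λ c → ((x + k) ≡ᵇ proj₁ c) ∧ (j ≡ᵇ proj₂ c)) (map (λ pq → (x + proj₁ pq , Y + proj₂ pq)) l)
           ≡ any (λ c → (k ≡ᵇ proj₁ c) ∧ (j ≡ᵇ proj₂ c)) (map (λ pq → (0 + proj₁ pq , Y + proj₂ pq)) l)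
  go [] = refl
  go ((p , q) ∷ l) rewrite ≡ᵇ-cancelˡ-+ x k p | go l = refl

hasCell-<ˣ : ∀ o x Y i j → i < x → hasCell (o , x , Y) i j ≡ false
hasCell-<ˣ o x Y i j i<x = go (offsets o)
  where
  go : ∀ l → any (λ c → (i ≡ᵇ proj₁ c) ∧ (j ≡ᵇ proj₂ c)) (map (λ pq → (x + proj₁ pq , Y + proj₂ pq)) l) ≡ false
  go [] = refl
  go ((p , q) ∷ l) rewrite m<n⇒m≢ᵇn i (x + p) (ℕₚ.<-≤-trans i<x (ℕₚ.m≤m+n x p)) = go l

hasCell⇒inRect : ∀ n d i j → Fits n d → hasCell d i j ≡ true → (i < n) × (j < 4)
hasCell⇒inRect n d i j fits e = All.lookup (cells-inRect d fits) (Equivalence.to (hasCell⇔ d i j) e)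

hasCell⇒X≤i : ∀ o X Y i j → hasCell (o , X , Y) i j ≡ true → X ≤ i
hasCell⇒X≤i o X Y i j e = ℕₚ.≮⇒≥ λ i<X → true≢false (trans (sym e) (hasCell-<ˣ o X Y i j i<X))

hasCell-firstColumn : ∀ o X Y → ∃ λ q → hasCell (o , X , Y) X (Y + q) ≡ true
hasCell-firstColumn o X Y = q , Equivalence.from (hasCell⇔ (o , X , Y) X (Y + q)) (subst (λ i → (i , Y + q) ∈ cells (o , X , Y)) (ℕₚ.+-identityʳ X) first∈)
  where
  q : ℕ
  q = firstColumnRow o
  first∈ : (X + 0 , Y + q) ∈ cells (o , X , Y)
  first∈ = ∈-map⁺ (λ pq → (X + proj₁ pq , Y + proj₂ pq)) (firstColumnRow∈ o)

∈-map-toPoint⇔ : ∀ i j l → (+ i , + j) ∈ map toPoint l ⇔ (i , j) ∈ l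
∈-map-toPoint⇔ i j l = mk⇔ from-point (∈-map⁺ toPoint)
  where
  from-point : (+ i , + j) ∈ map toPoint l → (i , j) ∈ l
  from-point m with ∈-map⁻ toPoint m
  ... | (i′ , j′) , c∈l , e = subst (_∈ l) (sym (cong₂ _,_ (ℤₚ.+-injective (cong proj₁ e)) (ℤₚ.+-injective (cong proj₂ e)))) c∈l

region∋⇔ : ∀ {n} d (i : Fin n) (j : Fin 4) → region d ∋ (i , j) ⇔ (+ toℕ i , + toℕ j) ∈ map toPoint (cells d)
region∋⇔ d i j = ⇔-sym (∈-map-toPoint⇔ (toℕ i) (toℕ j) (cells d)) ⇔-∘
  (hasCell⇔ d (toℕ i) (toℕ j) ⇔-∘ mk⇔ (trans (sym (lookup-region d i j))) (trans (lookup-region d i j)))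

private
  placeT-cells : ∀ sw fx fy X Y →
    placeT sw fx fy (+ X ℤ.+ originX sw fx fy) (+ Y ℤ.+ originY sw fx fy) ↭ map toPoint (cells (orientation sw fx fy , X , Y))
  placeT-cells sw fx fy X Y = ↭-trans (↭-reflexive (placeT-translate sw fx fy (+ X) (+ Y) (originX sw fx fy) (originY sw fx fy)))
    (↭-trans (↭.map⁺ (translate (+ X) (+ Y)) (placeT-origin sw fx fy)) (↭-reflexive (translate-cells (orientation sw fx fy) X Y)))

  placed-isTCopy : ∀ {n} sw fx fy X Y → Fits n (orientation sw fx fy , X , Y) →
    IsTCopy (region {n} (orientation sw fx fy , X , Y))
  placed-isTCopy sw fx fy X Y fits = sw , fx , fy , + X ℤ.+ originX sw fx fy , + Y ℤ.+ originY sw fx fy ,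
    ↭.All-resp-↭ (↭-sym (placeT-cells sw fx fy X Y)) (All.map⁺ (All.map (λ (i<n , j<4) → _ , _ , refl , refl , i<n , j<4) (cells-inRect _ fits))) ,
    λ i j → ∈-resp-↭⇔ (↭-sym (placeT-cells sw fx fy X Y)) ⇔-∘ region∋⇔ _ i j

region-isTCopy : ∀ {n} d → Fits n d → IsTCopy (region {n} d)
region-isTCopy (up    , X , Y) = placed-isTCopy false false false X Y
region-isTCopy (down  , X , Y) = placed-isTCopy false false true  X Y
region-isTCopy (right , X , Y) = placed-isTCopy true  false false X Y
region-isTCopy (left  , X , Y) = placed-isTCopy true  true  false X Y

isTCopy⇒region : ∀ {n} {R : Region n} → IsTCopy R → ∃ λ d → Fits n d × R ≡ region d
isTCopy⇒region (sw , fx , fy , a , b , inRect , R⇔)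
  with inRect-anchor (orientation sw fx fy) (a ℤ.- originX sw fx fy) (b ℤ.- originY sw fx fy) (↭.All-resp-↭ (placeT-translated-origin sw fx fy a b) inRect)
... | X , Y , a≡X , b≡Y , fits = (o , X , Y) , fits , region-ext λ i j → ⇔-sym (region∋⇔ _ i j) ⇔-∘ (∈-resp-↭⇔ placement ⇔-∘ R⇔ i j)
  where
  o = orientation sw fx fy
  placement : placeT sw fx fy a b ↭ map toPoint (cells (o , X , Y))
  placement = ↭-trans (placeT-translated-origin sw fx fy a b)
    (↭-reflexive (trans (cong₂ (λ a b → map (translate a b) (map toPoint (cells (o , 0 , 0)))) a≡X b≡Y) (translate-cells o X Y)))

-- The column-by-column search

Column : Set
Column = Vec Bool 4

Window : Set
Window = Vec Column 3

lookupOr : ∀ {A : Set} {n} → A → Vec A n → ℕ → A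
lookupOr d [] _ = d
lookupOr d (a ∷ v) zero = a
lookupOr d (a ∷ v) (suc k) = lookupOr d v k

emptyColumn : Column
emptyColumn = false ∷ false ∷ false ∷ false ∷ []

-- Cells outside the window read as unfilled.
filled : Window → ℕ → ℕ → Bool
filled o k j = lookupOr false (lookupOr emptyColumn o k) j

tabulateWindow : (ℕ → ℕ → Bool) → Window
tabulateWindow f = col 0 ∷ col 1 ∷ col 2 ∷ []
  where col : ℕ → Column
        col k = f k 0 ∷ f k 1 ∷ f k 2 ∷ f k 3 ∷ []

Choice : Set
Choice = Orientation × ℕ

covers : Choice → ℕ → ℕ → Bool
covers (or , Y) k j = hasCell (or , 0 , Y) k j

place : Window → Choice → Window
place o c = tabulateWindow (λ k j → filled o k j ∨ covers c k j)

advance : Window → Window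
advance (c0 ∷ c1 ∷ c2 ∷ []) = c1 ∷ c2 ∷ emptyColumn ∷ []

isEmptyColumn : Column → Bool
isEmptyColumn (a ∷ b ∷ c ∷ d ∷ []) = not (a ∨ b ∨ c ∨ d)

isEmptyWindow : Window → Bool
isEmptyWindow (c0 ∷ c1 ∷ c2 ∷ []) = isEmptyColumn c0 ∧ isEmptyColumn c1 ∧ isEmptyColumn c2

allFree : Window → List (ℕ × ℕ) → Bool
allFree o [] = true
allFree o ((k , j) ∷ l) = not (filled o k j) ∧ allFree o l

allChoices : List Choice
allChoices = (up , 0) ∷ (up , 1) ∷ (up , 2) ∷ (up , 3) ∷ (down , 0) ∷ (down , 1) ∷ (down , 2) ∷ (down , 3) ∷
          (right , 0) ∷ (right , 1) ∷ (right , 2) ∷ (right , 3) ∷ (left , 0) ∷ (left , 1) ∷ (left , 2) ∷ (left , 3) ∷ []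

canPlace : Window → ℕ → Choice → Bool
canPlace o j (or , Y) = ((Y + height or) ≤ᵇ 4) ∧ hasCell (or , 0 , Y) 0 j ∧ allFree o (cells (or , 0 , Y))

candidatesIn : Window → ℕ → List Choice → List Choice
candidatesIn o j [] = []
candidatesIn o j (c ∷ cs) = if canPlace o j c then c ∷ candidatesIn o j cs else candidatesIn o j cs

candidates : Window → ℕ → List Choice
candidates o j = candidatesIn o j allChoices

isSuc : ℕ → Bool
isSuc zero    = false
isSuc (suc _) = true

rows : List ℕ
rows = 0 ∷ 1 ∷ 2 ∷ 3 ∷ []

atColumn : ℕ → Choice → Placement
atColumn x (o , Y) = (o , x , Y)

fitsWithin : ℕ → Choice → Bool
fitsWithin r (o , _) = width o ≤ᵇ suc r

-- Column-by-column enumeration of the tilings of the columns x, …, x + r - 1: the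
-- window records which cells of columns x, x + 1, x + 2 are already covered, and the
-- first free cell of column x (scanning the rows js) is covered by a tile whose
-- leftmost column is x.  With the flag set, a window that becomes empty before the
-- right end is a fault, and the branch is cut.
mutual
  completions : Bool → ℕ → ℕ → Window → List (List Placement)
  completions b zero    x o = [] ∷ []
  completions b (suc r) x o = fillColumn b r x o rows

  fillColumn : Bool → ℕ → ℕ → Window → List ℕ → List (List Placement)
  fillColumn b r x o []       = nextColumn b r x o
  fillColumn b r x o (j ∷ js) =
    if filled o 0 j then fillColumn b r x o js else concatMap (branch b r x o js) (candidates o j)

  branch : Bool → ℕ → ℕ → Window → List ℕ → Choice → List (List Placement)
  branch b r x o js c = if fitsWithin r c then map (atColumn x c ∷_) (fillColumn b r x (place o c) js) else []

  nextColumn : Bool → ℕ → ℕ → Window → List (List Placement)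
  nextColumn b r x o = if isEmptyWindow (advance o) ∧ isSuc r ∧ b then [] else completions b r (suc x) (advance o)

mutual
  #completions : Bool → ℕ → Window → ℕ
  #completions b zero    o = 1
  #completions b (suc r) o = #fillColumn b r o rows

  #fillColumn : Bool → ℕ → Window → List ℕ → ℕ
  #fillColumn b r o []       = #nextColumn b r o
  #fillColumn b r o (j ∷ js) =
    if filled o 0 j then #fillColumn b r o js else sumMap (#branch b r o js) (candidates o j)

  #branch : Bool → ℕ → Window → List ℕ → Choice → ℕ
  #branch b r o js c = if fitsWithin r c then #fillColumn b r (place o c) js else 0

  #nextColumn : Bool → ℕ → Window → ℕ
  #nextColumn b r o = if isEmptyWindow (advance o) ∧ isSuc r ∧ b then 0 else #completions b r (advance o)

mutual
  length-completions : ∀ b r x o → length (completions b r x o) ≡ #completions b r o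
  length-completions b zero    x o = refl
  length-completions b (suc r) x o = length-fillColumn b r x o rows

  length-fillColumn : ∀ b r x o js → length (fillColumn b r x o js) ≡ #fillColumn b r o js
  length-fillColumn b r x o [] = length-nextColumn b r x o
  length-fillColumn b r x o (j ∷ js) with filled o 0 j
  ... | true  = length-fillColumn b r x o js
  ... | false = length-concatMap (branch b r x o js) (#branch b r o js) (length-branch b r x o js) (candidates o j)

  length-branch : ∀ b r x o js c → length (branch b r x o js c) ≡ #branch b r o js c
  length-branch b r x o js c with fitsWithin r c
  ... | true  = trans (length-map _ (fillColumn b r x (place o c) js)) (length-fillColumn b r x (place o c) js)
  ... | false = refl

  length-nextColumn : ∀ b r x o → length (nextColumn b r x o) ≡ #nextColumn b r o
  length-nextColumn b r x o with isEmptyWindow (advance o) ∧ isSuc r ∧ b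
  ... | true  = refl
  ... | false = length-completions b r (suc x) (advance o)

emptyWindow : Window
emptyWindow = emptyColumn ∷ emptyColumn ∷ emptyColumn ∷ []

#tilings : Bool → ℕ → ℕ
#tilings b n = #completions b n emptyWindow

-- The recurrences

-- The two windows left after the first column (rows listed bottom to top):
--   s₁ : column x = ■■■□, column x+1 = ■□□□      s₂ : its mirror image in the horizontal axis.
s₁ s₂ : Window
s₁ = (true ∷ true ∷ true ∷ false ∷ []) ∷ (true ∷ false ∷ false ∷ false ∷ []) ∷ emptyColumn ∷ []
s₂ = (false ∷ true ∷ true ∷ true ∷ []) ∷ (false ∷ false ∷ false ∷ true ∷ []) ∷ emptyColumn ∷ []

restart : Bool → ℕ → ℕ
restart b r = if b then 0 else #tilings b (3 + r)

#tilings-first : ∀ b r → #tilings b (3 + r) ≡ #completions b (2 + r) s₁ + #completions b (2 + r) s₂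
#tilings-first b r = refl

-- After four more columns the search is back at s₁, or the first block of four columns
-- is complete and the rest is tiled from scratch.
#completions-s₁ : ∀ b r → #completions b (6 + r) s₁ ≡ #completions b (2 + r) s₁ + restart b r
#completions-s₁ b r = refl

#completions-s₂ : ∀ b r → #completions b (6 + r) s₂ ≡ #completions b (2 + r) s₂ + restart b r
#completions-s₂ b r = refl

#tilings-period : ∀ b r → #tilings b (7 + r) ≡ #tilings b (3 + r) + (restart b r + restart b r)
#tilings-period b r = begin
  #tilings b (7 + r)                                                         ≡⟨ #tilings-first b (4 + r) ⟩
  #completions b (6 + r) s₁ + #completions b (6 + r) s₂                      ≡⟨ cong₂ _+_ (#completions-s₁ b r) (#completions-s₂ b r) ⟩
  (#completions b (2 + r) s₁ + restart b r) + (#completions b (2 + r) s₂ + restart b r) ≡⟨ interchange (#completions b (2 + r) s₁) (restart b r) (#completions b (2 + r) s₂) (restart b r) ⟩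
  #tilings b (3 + r) + (restart b r + restart b r)                           ∎
  where open ≡-Reasoning

#tilings-step : ∀ r → #tilings false (7 + r) ≡ 3 * #tilings false (3 + r)
#tilings-step r = trans (#tilings-period false r) (cong (λ t → N + (N + t)) (sym (ℕₚ.+-identityʳ N)))
  where N = #tilings false (3 + r)

#faultFree-step : ∀ r → #tilings true (7 + r) ≡ #tilings true (3 + r)
#faultFree-step r = trans (#tilings-period true r) (ℕₚ.+-identityʳ _)

#tilings≡Nclosed : ∀ t → #tilings false (4 * t) ≡ Nclosed t
#tilings≡Nclosed zero    = refl
#tilings≡Nclosed (suc t) = trans (cong (#tilings false) (ℕₚ.*-suc 4 t)) (block t)
  where
  open ≡-Reasoning
  block : ∀ t → #tilings false (4 + 4 * t) ≡ 2 * 3 ^ t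
  block zero    = refl
  block (suc t) = begin
    #tilings false (4 + 4 * suc t) ≡⟨ cong (λ k → #tilings false (4 + k)) (ℕₚ.*-suc 4 t) ⟩
    #tilings false (8 + 4 * t)     ≡⟨ #tilings-step (1 + 4 * t) ⟩
    3 * #tilings false (4 + 4 * t) ≡⟨ cong (3 *_) (block t) ⟩
    3 * (2 * 3 ^ t)                ≡⟨ ℕₚ.*-comm 3 (2 * 3 ^ t) ⟩
    2 * 3 ^ t * 3                  ≡⟨ ℕₚ.*-assoc 2 (3 ^ t) 3 ⟩
    2 * (3 ^ t * 3)                ≡⟨ cong (2 *_) (ℕₚ.*-comm (3 ^ t) 3) ⟩
    2 * 3 ^ suc t                  ∎

#faultFree≡2 : ∀ t → 1 ≤ t → #tilings true (4 * t) ≡ 2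
#faultFree≡2 (suc t) _ = trans (cong (#tilings true) (ℕₚ.*-suc 4 t)) (block t)
  where
  block : ∀ t → #tilings true (4 + 4 * t) ≡ 2
  block zero    = refl
  block (suc t) = trans (cong (λ k → #tilings true (4 + k)) (ℕₚ.*-suc 4 t))
    (trans (#faultFree-step (1 + 4 * t)) (block t))

4∣n⊎#tilings≡0 : ∀ n → (4 ∣ n) ⊎ (#tilings false n ≡ 0)
4∣n⊎#tilings≡0 zero = inj₁ (divides 0 refl)
4∣n⊎#tilings≡0 (suc zero) = inj₂ refl
4∣n⊎#tilings≡0 (suc (suc zero)) = inj₂ refl
4∣n⊎#tilings≡0 (suc (suc (suc zero))) = inj₂ refl
4∣n⊎#tilings≡0 (suc (suc (suc (suc zero)))) = inj₁ (divides 1 refl)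
4∣n⊎#tilings≡0 (suc (suc (suc (suc (suc zero))))) = inj₂ refl
4∣n⊎#tilings≡0 (suc (suc (suc (suc (suc (suc zero)))))) = inj₂ refl
4∣n⊎#tilings≡0 (suc (suc (suc (suc (suc (suc (suc zero))))))) = inj₂ refl
4∣n⊎#tilings≡0 (suc (suc (suc (suc n@(suc (suc (suc (suc r)))))))) with 4∣n⊎#tilings≡0 n
... | inj₁ (divides q e) = inj₁ (divides (suc q) (cong (λ k → 4 + k) e))
... | inj₂ z = inj₂ (trans (#tilings-step (1 + r)) (cong (3 *_) z))

-- Coverage

covered : ℕ → Window → ℕ → ℕ → Bool
covered x o i j = (i <ᵇ x) ∨ ((x ≤ᵇ i) ∧ filled o (i ∸ x) j)

covered-< : ∀ x o i j → i < x → covered x o i j ≡ true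
covered-< x o i j p rewrite m<n⇒m<ᵇn i x p = refl

covered-+ : ∀ x o k j → covered x o (x + k) j ≡ filled o k j
covered-+ x o k j rewrite n≤m⇒m≮ᵇn (x + k) x (ℕₚ.m≤m+n x k) | m≤n⇒m≤ᵇn x (x + k) (ℕₚ.m≤m+n x k) | ℕₚ.m+n∸m≡n x k = refl

filled-tabulateWindow : ∀ f k j → k < 3 → j < 4 → filled (tabulateWindow f) k j ≡ f k j
filled-tabulateWindow f 0 0 _ _ = refl
filled-tabulateWindow f 0 1 _ _ = refl
filled-tabulateWindow f 0 2 _ _ = refl
filled-tabulateWindow f 0 3 _ _ = refl
filled-tabulateWindow f 1 0 _ _ = refl
filled-tabulateWindow f 1 1 _ _ = refl
filled-tabulateWindow f 1 2 _ _ = refl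
filled-tabulateWindow f 1 3 _ _ = refl
filled-tabulateWindow f 2 0 _ _ = refl
filled-tabulateWindow f 2 1 _ _ = refl
filled-tabulateWindow f 2 2 _ _ = refl
filled-tabulateWindow f 2 3 _ _ = refl
filled-tabulateWindow f (suc (suc (suc k))) j (s≤s (s≤s (s≤s ()))) _
filled-tabulateWindow f k (suc (suc (suc (suc j)))) _ (s≤s (s≤s (s≤s (s≤s ()))))

lookupOr-emptyColumn : ∀ j → lookupOr false emptyColumn j ≡ false
lookupOr-emptyColumn 0 = refl
lookupOr-emptyColumn 1 = refl
lookupOr-emptyColumn 2 = refl
lookupOr-emptyColumn 3 = refl
lookupOr-emptyColumn (suc (suc (suc (suc j)))) = refl

filled-beyondWindow : ∀ o k j → filled o (3 + k) j ≡ false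
filled-beyondWindow (c0 ∷ c1 ∷ c2 ∷ []) k j = lookupOr-emptyColumn j

lookupOr-aboveTop : ∀ (c : Column) j → lookupOr false c (4 + j) ≡ false
lookupOr-aboveTop (a ∷ b ∷ c ∷ d ∷ []) j = refl

filled-aboveTop : ∀ o k j → filled o k (4 + j) ≡ false
filled-aboveTop o k j = lookupOr-aboveTop (lookupOr emptyColumn o k) j

covers-beyondWindow : ∀ c k j → covers c (3 + k) j ≡ false
covers-beyondWindow (up , Y) k j = refl
covers-beyondWindow (down , Y) k j = refl
covers-beyondWindow (right , Y) k j = refl
covers-beyondWindow (left , Y) k j = refl

filled-place : ∀ o c k j → j < 4 → filled (place o c) k j ≡ (filled o k j ∨ covers c k j)
filled-place o c 0 j p = filled-tabulateWindow (λ k j → filled o k j ∨ covers c k j) 0 j (s≤s z≤n) p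
filled-place o c 1 j p = filled-tabulateWindow (λ k j → filled o k j ∨ covers c k j) 1 j (s≤s (s≤s z≤n)) p
filled-place o c 2 j p = filled-tabulateWindow (λ k j → filled o k j ∨ covers c k j) 2 j (s≤s (s≤s (s≤s z≤n))) p
filled-place o c (suc (suc (suc k))) j p rewrite filled-beyondWindow (place o c) k j | filled-beyondWindow o k j | covers-beyondWindow c k j = refl

covered-place : ∀ x o c i j → j < 4 → covered x (place o c) i j ≡ (covered x o i j ∨ hasCell (proj₁ c , x , proj₂ c) i j)
covered-place x o c i j p with below-or-offset x i
... | inj₁ lt rewrite covered-< x (place o c) i j lt | covered-< x o i j lt = refl
... | inj₂ (k , refl) rewrite covered-+ x (place o c) k j | covered-+ x o k j | hasCell-+ˣ (proj₁ c) x (proj₂ c) k j = filled-place o c k j p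

filled-advance : ∀ o k j → filled (advance o) k j ≡ filled o (suc k) j
filled-advance (c0 ∷ c1 ∷ c2 ∷ []) 0 j = refl
filled-advance (c0 ∷ c1 ∷ c2 ∷ []) 1 j = refl
filled-advance (c0 ∷ c1 ∷ c2 ∷ []) 2 j = refl
filled-advance (c0 ∷ c1 ∷ c2 ∷ []) (suc (suc (suc k))) j = refl

covered-advance-false : ∀ x o i j → covered (suc x) (advance o) i j ≡ false → covered x o i j ≡ false
covered-advance-false x o i j e with below-or-offset (suc x) i
... | inj₁ lt rewrite covered-< (suc x) (advance o) i j lt = ⊥-elim (true≢false e)
... | inj₂ (k , refl) rewrite covered-+ (suc x) (advance o) k j | sym (ℕₚ.+-suc x k) | covered-+ x o (suc k) j = trans (sym (filled-advance o k j)) e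

FirstColumnFull : Window → Set
FirstColumnFull o = ∀ j → j < 4 → filled o 0 j ≡ true

covered-advance : ∀ x o → FirstColumnFull o → ∀ i j → j < 4 → covered (suc x) (advance o) i j ≡ covered x o i j
covered-advance x o f i j p with below-or-offset x i
... | inj₁ lt rewrite covered-< x o i j lt | covered-< (suc x) (advance o) i j (ℕₚ.m<n⇒m<1+n lt) = refl
... | inj₂ (zero , refl) rewrite covered-+ x o 0 j | f j p | m<n⇒m<ᵇn (x + 0) (suc x) (s≤s (ℕₚ.≤-reflexive (ℕₚ.+-identityʳ x))) = refl
... | inj₂ (suc k , refl) rewrite covered-+ x o (suc k) j = trans (cong (λ i → covered (suc x) (advance o) i j) (ℕₚ.+-suc x k)) (trans (covered-+ (suc x) (advance o) k j) (filled-advance o k j))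

mutual
  data Completion (b : Bool) : ℕ → ℕ → Window → List Placement → Set where
    finished : ∀ {x o} → Completion b zero x o []
    startColumn : ∀ {r x o ds} → FillColumn b r x o rows ds → Completion b (suc r) x o ds

  data FillColumn (b : Bool) : ℕ → ℕ → Window → List ℕ → List Placement → Set where
    columnDone : ∀ {r x o ds} → NextColumn b r x o ds → FillColumn b r x o [] ds
    skipFilled : ∀ {r x o j js ds} → filled o 0 j ≡ true → FillColumn b r x o js ds → FillColumn b r x o (j ∷ js) ds
    placeTile : ∀ {r x o j js ds} c → filled o 0 j ≡ false → c ∈ candidates o j → fitsWithin r c ≡ true →
             FillColumn b r x (place o c) js ds → FillColumn b r x o (j ∷ js) (atColumn x c ∷ ds)

  data NextColumn (b : Bool) : ℕ → ℕ → Window → List Placement → Set where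
    moveOn : ∀ {r x o ds} → (isEmptyWindow (advance o) ∧ isSuc r ∧ b) ≡ false → Completion b r (suc x) (advance o) ds → NextColumn b r x o ds

∈-branch⁻ : ∀ b r x o js c ds → ds ∈ branch b r x o js c → (fitsWithin r c ≡ true) × ∃ λ rest → (rest ∈ fillColumn b r x (place o c) js) × (ds ≡ atColumn x c ∷ rest)
∈-branch⁻ b r x o js c ds m = go (fitsWithin r c) refl m
  where
  go : ∀ t → fitsWithin r c ≡ t → ds ∈ (if t then map (atColumn x c ∷_) (fillColumn b r x (place o c) js) else []) →
       (fitsWithin r c ≡ true) × ∃ λ rest → (rest ∈ fillColumn b r x (place o c) js) × (ds ≡ atColumn x c ∷ rest)
  go true e m' = e , ∈-map⁻ (atColumn x c ∷_) m'
  go false e ()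

mutual
  ∈-completions⁻ : ∀ b r x o ds → ds ∈ completions b r x o → Completion b r x o ds
  ∈-completions⁻ b zero x o .[] (here refl) = finished
  ∈-completions⁻ b (suc r) x o ds m = startColumn (∈-fillColumn⁻ b r x o rows ds m)

  ∈-fillColumn⁻ : ∀ b r x o js ds → ds ∈ fillColumn b r x o js → FillColumn b r x o js ds
  ∈-fillColumn⁻ b r x o [] ds m = columnDone (∈-nextColumn⁻ b r x o ds m)
  ∈-fillColumn⁻ b r x o (j ∷ js) ds m = go (filled o 0 j) refl m
    where
    go : ∀ t → filled o 0 j ≡ t → ds ∈ (if t then fillColumn b r x o js else concatMap (branch b r x o js) (candidates o j)) → FillColumn b r x o (j ∷ js) ds
    go true e m' = skipFilled e (∈-fillColumn⁻ b r x o js ds m')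
    go false e m' = fromBranch (find (∈-concatMap⁻ (branch b r x o js) m'))
      where
      fromBranch′ : ∀ c → c ∈ candidates o j → (fitsWithin r c ≡ true) × (∃ λ rest → (rest ∈ fillColumn b r x (place o c) js) × (ds ≡ atColumn x c ∷ rest)) → FillColumn b r x o (j ∷ js) ds
      fromBranch′ c c∈ (ef , rest , r∈ , eq) = subst (FillColumn b r x o (j ∷ js)) (sym eq) (placeTile c e c∈ ef (∈-fillColumn⁻ b r x (place o c) js rest r∈))
      fromBranch : (∃ λ c → (c ∈ candidates o j) × (ds ∈ branch b r x o js c)) → FillColumn b r x o (j ∷ js) ds
      fromBranch (c , c∈ , m2) = fromBranch′ c c∈ (∈-branch⁻ b r x o js c ds m2)

  ∈-nextColumn⁻ : ∀ b r x o ds → ds ∈ nextColumn b r x o → NextColumn b r x o ds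
  ∈-nextColumn⁻ b r x o ds m = go (isEmptyWindow (advance o) ∧ isSuc r ∧ b) refl m
    where
    go : ∀ t → (isEmptyWindow (advance o) ∧ isSuc r ∧ b) ≡ t → ds ∈ (if t then [] else completions b r (suc x) (advance o)) → NextColumn b r x o ds
    go false e m' = moveOn e (∈-completions⁻ b r (suc x) (advance o) ds m')
    go true e ()

mutual
  ∈-completions⁺ : ∀ {b r x o ds} → Completion b r x o ds → ds ∈ completions b r x o
  ∈-completions⁺ finished = here refl
  ∈-completions⁺ (startColumn p) = ∈-fillColumn⁺ p

  ∈-fillColumn⁺ : ∀ {b r x o js ds} → FillColumn b r x o js ds → ds ∈ fillColumn b r x o js
  ∈-fillColumn⁺ (columnDone p) = ∈-nextColumn⁺ p
  ∈-fillColumn⁺ {b} {r} {x} {o} {j ∷ js} {ds} (skipFilled e p) =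
    subst (λ t → ds ∈ (if t then fillColumn b r x o js else concatMap (branch b r x o js) (candidates o j))) (sym e) (∈-fillColumn⁺ p)
  ∈-fillColumn⁺ {b} {r} {x} {o} {j ∷ js} (placeTile {ds = ds} c e c∈ ef p) =
    subst (λ t → (atColumn x c ∷ ds) ∈ (if t then fillColumn b r x o js else concatMap (branch b r x o js) (candidates o j))) (sym e)
      (∈-concatMap⁺ (branch b r x o js) (lose c∈ (subst (λ z → _ ∈ (if z then map (atColumn x c ∷_) (fillColumn b r x (place o c) js) else [])) (sym ef) (∈-map⁺ (atColumn x c ∷_) (∈-fillColumn⁺ p)))))

  ∈-nextColumn⁺ : ∀ {b r x o ds} → NextColumn b r x o ds → ds ∈ nextColumn b r x o
  ∈-nextColumn⁺ {b} {r} {x} {o} {ds} (moveOn e p) = subst (λ t → ds ∈ (if t then [] else completions b r (suc x) (advance o))) (sym e) (∈-completions⁺ p)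

∈-candidatesIn⇒canPlace : ∀ o j cs c → c ∈ candidatesIn o j cs → canPlace o j c ≡ true
∈-candidatesIn⇒canPlace o j (c' ∷ cs) c m with canPlace o j c' in e
∈-candidatesIn⇒canPlace o j (c' ∷ cs) c (here refl) | true = e
∈-candidatesIn⇒canPlace o j (c' ∷ cs) c (there m) | true = ∈-candidatesIn⇒canPlace o j cs c m
... | false = ∈-candidatesIn⇒canPlace o j cs c m

canPlace⇒∈-candidatesIn : ∀ o j cs c → c ∈ cs → canPlace o j c ≡ true → c ∈ candidatesIn o j cs
canPlace⇒∈-candidatesIn o j (c' ∷ cs) c (here refl) v rewrite v = here refl
canPlace⇒∈-candidatesIn o j (c' ∷ cs) c (there m) v with canPlace o j c'
... | true = there (canPlace⇒∈-candidatesIn o j cs c m v)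
... | false = canPlace⇒∈-candidatesIn o j cs c m v

allFree⇒unfilled : ∀ o l k j → allFree o l ≡ true → (k , j) ∈ l → filled o k j ≡ false
allFree⇒unfilled o ((k' , j') ∷ l) k j e (here refl) with filled o k' j'
... | false = refl
allFree⇒unfilled o ((k' , j') ∷ l) k j e (there m) with filled o k' j'
... | false = allFree⇒unfilled o l k j e m

canPlace⁻ : ∀ o j or Y → canPlace o j (or , Y) ≡ true →
  (Y + height or ≤ 4) × (hasCell (or , 0 , Y) 0 j ≡ true) × (∀ k j' → hasCell (or , 0 , Y) k j' ≡ true → filled o k j' ≡ false)
canPlace⁻ o j or Y v with ∧-true⁻ v
... | v1 , v23 with ∧-true⁻ v23
... | v2 , v3 = m≤ᵇn⇒m≤n (Y + height or) 4 v1 , v2 ,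
  λ k j' e → allFree⇒unfilled o (cells (or , 0 , Y)) k j' v3 (Equivalence.to (hasCell⇔ (or , 0 , Y) k j') e)

filled⇒row<4 : ∀ o k j → filled o k j ≡ true → j < 4
filled⇒row<4 o k 0 _ = s≤s z≤n
filled⇒row<4 o k 1 _ = s≤s (s≤s z≤n)
filled⇒row<4 o k 2 _ = s≤s (s≤s (s≤s z≤n))
filled⇒row<4 o k 3 _ = s≤s (s≤s (s≤s (s≤s z≤n)))
filled⇒row<4 o k (suc (suc (suc (suc j)))) e = ⊥-elim (true≢false (trans (sym e) (filled-aboveTop o k j)))

nonEmptyColumn : ∀ (c : Column) → isEmptyColumn c ≡ false → ∃ λ j → lookupOr false c j ≡ true
nonEmptyColumn (true ∷ b ∷ c ∷ d ∷ []) e = 0 , refl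
nonEmptyColumn (false ∷ true ∷ c ∷ d ∷ []) e = 1 , refl
nonEmptyColumn (false ∷ false ∷ true ∷ d ∷ []) e = 2 , refl
nonEmptyColumn (false ∷ false ∷ false ∷ true ∷ []) e = 3 , refl

nonEmptyWindow : ∀ o → isEmptyWindow o ≡ false → ∃₂ λ k j → filled o k j ≡ true
nonEmptyWindow (c0 ∷ c1 ∷ c2 ∷ []) e with isEmptyColumn c0 in e0
... | false = 0 , nonEmptyColumn c0 e0
... | true with isEmptyColumn c1 in e1
... | false = 1 , nonEmptyColumn c1 e1
... | true = 2 , nonEmptyColumn c2 e

Disjoint : Placement → Placement → Set
Disjoint d d' = ∀ i j → hasCell d i j ≡ true → hasCell d' i j ≡ false

Straddles : ℕ → Placement → Set
Straddles k d = (∃₂ λ i j → (hasCell d i j ≡ true) × (i < k)) × (∃₂ λ i j → (hasCell d i j ≡ true) × (k ≤ i))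

FreeRowsIn : Window → List ℕ → Set
FreeRowsIn o js = ∀ j → j < 4 → filled o 0 j ≡ false → j ∈ js

freeRowsIn-rows : ∀ o → FreeRowsIn o rows
freeRowsIn-rows o 0 _ _ = here refl
freeRowsIn-rows o 1 _ _ = there (here refl)
freeRowsIn-rows o 2 _ _ = there (there (here refl))
freeRowsIn-rows o 3 _ _ = there (there (there (here refl)))
freeRowsIn-rows o (suc (suc (suc (suc j)))) (s≤s (s≤s (s≤s (s≤s ())))) _

-- Soundness: every leaf is a tiling

module Soundness (n : ℕ) where

  -- In straddle, a filled window cell at a column x + k′ ≥ k stands for a tile placed
  -- earlier that crosses the line k.
  record Sound (b : Bool) (x : ℕ) (o : Window) (ds : List Placement) : Set where
    field
      fits : All (Fits n) ds
      avoid : All (λ d → ∀ i j → j < 4 → hasCell d i j ≡ true → covered x o i j ≡ false) ds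
      disjoint : AllPairs Disjoint ds
      coverAll : ∀ i j → i < n → j < 4 → covered x o i j ≡ false → Any (λ d → hasCell d i j ≡ true) ds
      straddle : b ≡ true → ∀ k → x < k → k < n → Any (Straddles k) ds ⊎ (∃₂ λ k' j → (k ≤ x + k') × (filled o k' j ≡ true))

  open Sound

  atColumn-disjoint : ∀ x o c ds → All (Fits n) ds →
    All (λ d → ∀ i j → j < 4 → hasCell d i j ≡ true → covered x (place o c) i j ≡ false) ds →
    All (Disjoint (atColumn x c)) ds
  atColumn-disjoint x o c [] [] [] = []
  atColumn-disjoint x o c (d' ∷ ds) (f ∷ fs) (h ∷ hs) = dj ∷ atColumn-disjoint x o c ds fs hs
    where
    dj : Disjoint (atColumn x c) d'
    dj i j m with hasCell d' i j in e'
    ... | false = refl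
    ... | true = ⊥-elim (true≢false (trans (sym (trans (covered-place x o c i j jl) (trans (cong (covered x o i j ∨_) m) (∨-zeroʳ _)))) (h i j jl e')))
      where
      jl = proj₂ (hasCell⇒inRect n d' i j f e')

  atColumn-uncovered : ∀ x o or Y → (∀ k j' → hasCell (or , 0 , Y) k j' ≡ true → filled o k j' ≡ false) →
           ∀ i j → j < 4 → hasCell (or , x , Y) i j ≡ true → covered x o i j ≡ false
  atColumn-uncovered x o or Y free i j jl m with below-or-offset x i
  ... | inj₁ lt = ⊥-elim (true≢false (trans (sym m) (hasCell-<ˣ or x Y i j lt)))
  ... | inj₂ (k , refl) = trans (covered-+ x o k j) (free k j (trans (sym (hasCell-+ˣ or x Y k j)) m))

  coverAll-∷ : ∀ x o c ds i j → j < 4 → (covered x (place o c) i j ≡ false → Any (λ d → hasCell d i j ≡ true) ds) →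
        covered x o i j ≡ false → Any (λ d → hasCell d i j ≡ true) (atColumn x c ∷ ds)
  coverAll-∷ x o c ds i j jl h u with hasCell (atColumn x c) i j in em
  ... | true = here em
  ... | false = there (h (trans (covered-place x o c i j jl) (cong₂ _∨_ u em)))

  emptyWindowAhead : ∀ x r o → x + suc r ≡ n → suc x < n → (isEmptyWindow (advance o) ∧ isSuc r ∧ true) ≡ false →
             ∃₂ λ k' j → (suc x ≤ x + k') × (filled o k' j ≡ true)
  emptyWindowAhead x zero o e kn c = ⊥-elim (ℕₚ.<-irrefl refl (subst (suc x <_) (sym (trans (ℕₚ.+-comm 1 x) e)) kn))
  emptyWindowAhead x (suc r') o e kn c with nonEmptyWindow (advance o) (trans (sym (∧-identityʳ _)) c)
  ... | k'' , j , oc = suc k'' , j , subst (suc x ≤_) (sym (ℕₚ.+-suc x k'')) (s≤s (ℕₚ.m≤m+n x k'')) , trans (sym (filled-advance o k'' j)) oc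

  mutual
    sound-completion : ∀ {b r x o ds} → x + r ≡ n → Completion b r x o ds → Sound b x o ds
    sound-completion {b} {zero} {x} {o} e finished = record
      { fits = [] ; avoid = [] ; disjoint = []
      ; coverAll = λ i j il jl u → ⊥-elim (true≢false (trans (sym (covered-< x o i j (subst (i <_) (sym (trans (sym (ℕₚ.+-identityʳ x)) e)) il))) u))
      ; straddle = λ _ k xk kn → ⊥-elim (ℕₚ.<-asym xk (subst (k <_) (sym (trans (sym (ℕₚ.+-identityʳ x)) e)) kn)) }
    sound-completion {o = o} e (startColumn p) = sound-fillColumn e (freeRowsIn-rows o) p

    sound-fillColumn : ∀ {b r x o js ds} → x + suc r ≡ n → FreeRowsIn o js → FillColumn b r x o js ds → Sound b x o ds
    sound-fillColumn {o = o} e fe (columnDone p) = sound-nextColumn e full p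
      where
      full : FirstColumnFull o
      full j jl with filled o 0 j in oc
      ... | true = refl
      ... | false with fe j jl oc
      ... | ()
    sound-fillColumn {o = o} {js = j0 ∷ js} e fe (skipFilled oc p) = sound-fillColumn e freeRows′ p
      where
      freeRows′ : FreeRowsIn o js
      freeRows′ j jl f with fe j jl f
      ... | here refl = ⊥-elim (true≢false (trans (sym oc) f))
      ... | there m = m
    sound-fillColumn {b} {r} {x} {o} {j0 ∷ js} {_ ∷ ds} e fe (placeTile (or , Y) e0 c∈ ef p) = record
      { fits = fitsD ∷ fits ih
      ; avoid = dfree ∷ All.map (λ h i j jl m → proj₁ (∨-false⁻ (trans (sym (covered-place x o c i j jl)) (h i j jl m)))) (avoid ih)
      ; disjoint = atColumn-disjoint x o c ds (fits ih) (avoid ih) ∷ disjoint ih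
      ; coverAll = coverAll′
      ; straddle = straddle′ }
      where
      c = (or , Y)
      d = atColumn x c
      parts = canPlace⁻ o j0 or Y (∈-candidatesIn⇒canPlace o j0 allChoices c c∈)
      hY = proj₁ parts
      c0in = proj₁ (proj₂ parts)
      free = proj₂ (proj₂ parts)
      freeRows′ : FreeRowsIn (place o c) js
      freeRows′ j jl f with ∨-false⁻ (trans (sym (filled-place o c 0 j jl)) f)
      ... | f1 , f2 with fe j jl f1
      ... | here refl = ⊥-elim (true≢false (trans (sym c0in) f2))
      ... | there m = m
      ih = sound-fillColumn e freeRows′ p
      fitsD : Fits n d
      fitsD = subst (x + width or ≤_) e (ℕₚ.+-monoʳ-≤ x (m≤ᵇn⇒m≤n (width or) (suc r) ef)) , hY
      dfree : ∀ i j → j < 4 → hasCell d i j ≡ true → covered x o i j ≡ false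
      dfree = atColumn-uncovered x o or Y free
      coverAll′ : ∀ i j → i < n → j < 4 → covered x o i j ≡ false → Any (λ d → hasCell d i j ≡ true) (d ∷ ds)
      coverAll′ i j il jl u = coverAll-∷ x o c ds i j jl (coverAll ih i j il jl) u
      straddle′ : b ≡ true → ∀ k → x < k → k < n → Any (Straddles k) (d ∷ ds) ⊎ (∃₂ λ k' j → (k ≤ x + k') × (filled o k' j ≡ true))
      straddle′ bt k xk kn with straddle ih bt k xk kn
      ... | inj₁ a = inj₁ (there a)
      ... | inj₂ (k' , j , le , oc) with ∨-true⁻ (trans (sym (filled-place o c k' j (filled⇒row<4 (place o c) k' j oc))) oc)
      ... | inj₁ oc' = inj₂ (k' , j , le , oc')
      ... | inj₂ it = inj₁ (here ((x , j0 , trans (cong (λ z → hasCell d z j0) (sym (ℕₚ.+-identityʳ x))) (trans (hasCell-+ˣ or x Y 0 j0) c0in) , xk) ,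
                                   (x + k' , j , trans (hasCell-+ˣ or x Y k' j) it , le)))

    sound-nextColumn : ∀ {b r x o ds} → x + suc r ≡ n → FirstColumnFull o → NextColumn b r x o ds → Sound b x o ds
    sound-nextColumn {b} {r} {x} {o} {ds} e full (moveOn c p) = record
      { fits = fits ih
      ; avoid = All.map (λ h i j jl m → covered-advance-false x o i j (h i j jl m)) (avoid ih)
      ; disjoint = disjoint ih
      ; coverAll = λ i j il jl u → coverAll ih i j il jl (trans (covered-advance x o full i j jl) u)
      ; straddle = straddle′ }
      where
      ih = sound-completion (trans (sym (ℕₚ.+-suc x r)) e) p
      straddle′ : b ≡ true → ∀ k → x < k → k < n → Any (Straddles k) ds ⊎ (∃₂ λ k' j → (k ≤ x + k') × (filled o k' j ≡ true))
      straddle′ bt k xk kn with ℕₚ.m≤n⇒m<n∨m≡n xk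
      ... | inj₁ lt with straddle ih bt k lt kn
      ... | inj₁ a = inj₁ a
      ... | inj₂ (k' , j , le , oc) = inj₂ (suc k' , j , subst (k ≤_) (sym (ℕₚ.+-suc x k')) le , trans (sym (filled-advance o k' j)) oc)
      straddle′ bt k xk kn | inj₂ refl = inj₂ (emptyWindowAhead x r o e kn (subst (λ z → (isEmptyWindow (advance o) ∧ isSuc r ∧ z) ≡ false) bt c))

  emptyRegion : Region n
  emptyRegion = Vec.replicate n emptyColumn

  tileOf : List Placement → ℕ → ℕ → Region n
  tileOf [] i j = emptyRegion
  tileOf (d ∷ ds) i j = if hasCell d i j then region d else tileOf ds i j

  tileMap : List Placement → TileMap n
  tileMap ds = tabulate (λ i → tabulate (λ j → tileOf ds (toℕ i) (toℕ j)))

  tileAt-tileMap : ∀ ds i j → tileAt (tileMap ds) i j ≡ tileOf ds (toℕ i) (toℕ j)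
  tileAt-tileMap ds i j = trans (cong (λ v → lookup v j) (lookup∘tabulate (λ i → tabulate (λ j → tileOf ds (toℕ i) (toℕ j))) i))
    (lookup∘tabulate (λ j → tileOf ds (toℕ i) (toℕ j)) j)

  tileOf-∈ : ∀ ds {d} i j → AllPairs Disjoint ds → d ∈ ds → hasCell d i j ≡ true → tileOf ds i j ≡ region d
  tileOf-∈ (d' ∷ ds) i j (_ ∷ _) (here refl) m rewrite m = refl
  tileOf-∈ (d' ∷ ds) {d} i j (a ∷ ap) (there dm) m with hasCell d' i j in e
  ... | true = ⊥-elim (true≢false (trans (sym m) (All.lookup a dm i j e)))
  ... | false = tileOf-∈ ds i j ap dm m

  filled-emptyWindow : ∀ k j → filled emptyWindow k j ≡ false
  filled-emptyWindow 0 j = lookupOr-emptyColumn j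
  filled-emptyWindow 1 j = lookupOr-emptyColumn j
  filled-emptyWindow 2 j = lookupOr-emptyColumn j
  filled-emptyWindow (suc (suc (suc k))) j = filled-beyondWindow emptyWindow k j

  covered-emptyWindow : ∀ i j → covered 0 emptyWindow i j ≡ false
  covered-emptyWindow i j = filled-emptyWindow i j

  region-∋⇒hasCell : ∀ d (i : Fin n) (j : Fin 4) → region {n} d ∋ (i , j) → hasCell d (toℕ i) (toℕ j) ≡ true
  region-∋⇒hasCell d i j e = trans (sym (lookup-region d i j)) e

  tileMap-isTiling : ∀ {b ds} → Sound b 0 emptyWindow ds → IsTiling n (tileMap ds)
  tileMap-isTiling {b} {ds} S i j = a , bb , c
    where
    A = find (Sound.coverAll S (toℕ i) (toℕ j) (toℕ<n i) (toℕ<n j) (covered-emptyWindow (toℕ i) (toℕ j)))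
    d = proj₁ A
    d∈ = proj₁ (proj₂ A)
    m = proj₂ (proj₂ A)
    eq : tileAt (tileMap ds) i j ≡ region d
    eq = trans (tileAt-tileMap ds i j) (tileOf-∈ ds (toℕ i) (toℕ j) (Sound.disjoint S) d∈ m)
    a : tileAt (tileMap ds) i j ∋ (i , j)
    a = subst (λ R → R ∋ (i , j)) (sym eq) (trans (lookup-region d i j) m)
    bb : IsTCopy (tileAt (tileMap ds) i j)
    bb = subst IsTCopy (sym eq) (region-isTCopy d (All.lookup (Sound.fits S) d∈))
    c : ∀ i' j' → tileAt (tileMap ds) i j ∋ (i' , j') → tileAt (tileMap ds) i' j' ≡ tileAt (tileMap ds) i j
    c i' j' e' = trans (trans (tileAt-tileMap ds i' j') (tileOf-∈ ds (toℕ i') (toℕ j') (Sound.disjoint S) d∈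
                   (region-∋⇒hasCell d i' j' (subst (λ R → R ∋ (i' , j')) eq e')))) (sym eq)

  tileMap-faultFree : ∀ {ds} → Sound true 0 emptyWindow ds → FaultFree (tileMap ds)
  tileMap-faultFree {ds} S (k , k>0 , k<n , fault) with Sound.straddle S refl k k>0 k<n
  ... | inj₂ (k' , j , _ , oc) = true≢false (trans (sym oc) (filled-emptyWindow k' j))
  ... | inj₁ cr with find cr
  ... | d , d∈ , ((i1 , j1 , m1 , lt1) , (i2 , j2 , m2 , le2)) = go (fault fi1 fj1)
    where
    f = All.lookup (Sound.fits S) d∈
    in1 = hasCell⇒inRect n d i1 j1 f m1
    in2 = hasCell⇒inRect n d i2 j2 f m2
    fi1 = fromℕ< (proj₁ in1)
    fj1 = fromℕ< {m = j1} {n = 4} (proj₂ in1)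
    fi2 = fromℕ< (proj₁ in2)
    fj2 = fromℕ< {m = j2} {n = 4} (proj₂ in2)
    eqd : ∀ (i : Fin n) (j : Fin 4) → hasCell d (toℕ i) (toℕ j) ≡ true → tileAt (tileMap ds) i j ≡ region d
    eqd i j mm = trans (tileAt-tileMap ds i j) (tileOf-∈ ds (toℕ i) (toℕ j) (Sound.disjoint S) d∈ mm)
    m1' : hasCell d (toℕ fi1) (toℕ fj1) ≡ true
    m1' = subst₂ (λ u v → hasCell d u v ≡ true) (sym (toℕ-fromℕ< (proj₁ in1))) (sym (toℕ-fromℕ< (proj₂ in1))) m1
    m2' : hasCell d (toℕ fi2) (toℕ fj2) ≡ true
    m2' = subst₂ (λ u v → hasCell d u v ≡ true) (sym (toℕ-fromℕ< (proj₁ in2))) (sym (toℕ-fromℕ< (proj₂ in2))) m2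
    go : (∀ i' j' → tileAt (tileMap ds) fi1 fj1 ∋ (i' , j') → toℕ i' < k) ⊎
         (∀ i' j' → tileAt (tileMap ds) fi1 fj1 ∋ (i' , j') → k ≤ toℕ i') → ⊥
    go (inj₁ Lf) = ℕₚ.<⇒≱ (subst (_< k) (toℕ-fromℕ< (proj₁ in2)) (Lf fi2 fj2
        (subst (λ R → R ∋ (fi2 , fj2)) (sym (eqd fi1 fj1 m1')) (trans (lookup-region d fi2 fj2) m2')))) le2
    go (inj₂ Rt) = ℕₚ.<⇒≱ lt1 (subst (k ≤_) (toℕ-fromℕ< (proj₁ in1)) (Rt fi1 fj1
        (subst (λ R → R ∋ (fi1 , fj1)) (sym (eqd fi1 fj1 m1')) (trans (lookup-region d fi1 fj1) m1'))))

-- Injectivity: distinct leaves give distinct tile maps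

Distinguishable : Choice → Choice → Set
Distinguishable c c' = ∃₂ λ p q → (covers c p q ≡ true) × (covers c' p q ≡ false)

someCellOutside : List (ℕ × ℕ) → Choice → Bool
someCellOutside [] c' = false
someCellOutside ((p , q) ∷ l) c' = not (covers c' p q) ∨ someCellOutside l c'

someCellOutside⇒distinguishable : ∀ c l c' → (∀ p q → (p , q) ∈ l → covers c p q ≡ true) → someCellOutside l c' ≡ true → Distinguishable c c'
someCellOutside⇒distinguishable c ((p , q) ∷ l) c' h e with covers c' p q in e1
... | false = p , q , h p q (here refl) , e1
... | true = someCellOutside⇒distinguishable c l c' (λ p' q' m → h p' q' (there m)) e

distinguishable? : Choice → Choice → Bool
distinguishable? c c' = someCellOutside (cells (proj₁ c , 0 , proj₂ c)) c'

distinguishable?-sound : ∀ c c' → distinguishable? c c' ≡ true → Distinguishable c c'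
distinguishable?-sound c c' e = someCellOutside⇒distinguishable c _ c' (λ p q m → Equivalence.from (hasCell⇔ (proj₁ c , 0 , proj₂ c) p q) m) e

distinguishableFromAll? : Choice → List Choice → Bool
distinguishableFromAll? c [] = true
distinguishableFromAll? c (c' ∷ l) = distinguishable? c c' ∧ distinguishableFromAll? c l

pairwiseDistinguishable? : List Choice → Bool
pairwiseDistinguishable? [] = true
pairwiseDistinguishable? (c ∷ l) = distinguishableFromAll? c l ∧ pairwiseDistinguishable? l

pairwiseDistinguishable?-sound : ∀ l → pairwiseDistinguishable? l ≡ true → AllPairs Distinguishable l
pairwiseDistinguishable?-sound [] e = []
pairwiseDistinguishable?-sound (c ∷ l) e = go l (proj₁ (∧-true⁻ e)) ∷ pairwiseDistinguishable?-sound l (proj₂ (∧-true⁻ e))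
  where
  go : ∀ l' → distinguishableFromAll? c l' ≡ true → All (Distinguishable c) l'
  go [] _ = []
  go (c' ∷ l') e' = distinguishable?-sound c c' (proj₁ (∧-true⁻ e')) ∷ go l' (proj₂ (∧-true⁻ e'))

allChoices-distinguishable : AllPairs Distinguishable allChoices
allChoices-distinguishable = pairwiseDistinguishable?-sound allChoices refl

candidatesIn-distinguishable : ∀ o j cs → AllPairs Distinguishable cs → AllPairs Distinguishable (candidatesIn o j cs)
candidatesIn-distinguishable o j [] [] = []
candidatesIn-distinguishable o j (c ∷ cs) (a ∷ ap) with canPlace o j c
... | true = sub cs a ∷ candidatesIn-distinguishable o j cs ap
  where
  sub : ∀ cs' → All (Distinguishable c) cs' → All (Distinguishable c) (candidatesIn o j cs')
  sub [] [] = []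
  sub (c' ∷ cs') (d ∷ ds) with canPlace o j c'
  ... | true = d ∷ sub cs' ds
  ... | false = sub cs' ds
... | false = candidatesIn-distinguishable o j cs ap

module Injectivity (n : ℕ) where
  open Soundness n

  Separated : ℕ → Window → List Placement → List Placement → Set
  Separated x o ds ds' = ∃₂ λ i j → (i < n) × (j < 4) × (covered x o i j ≡ false) × (tileOf ds i j ≢ tileOf ds' i j)

  region-≢ : ∀ d d' i j → i < n → j < 4 → hasCell d i j ≡ true → hasCell d' i j ≡ false → region {n} d ≢ region d'
  region-≢ d d' i j il jl m m' eq = true≢false (trans (sym m1) (trans (cong (λ Rg → lookup (lookup Rg fi) fj) eq) m2))
    where
    fi = fromℕ< il
    fj = fromℕ< {m = j} {n = 4} jl
    m1 : lookup (lookup (region {n} d) fi) fj ≡ true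
    m1 = trans (lookup-region d fi fj) (subst₂ (λ u v → hasCell d u v ≡ true) (sym (toℕ-fromℕ< il)) (sym (toℕ-fromℕ< jl)) m)
    m2 : lookup (lookup (region {n} d') fi) fj ≡ false
    m2 = trans (lookup-region d' fi fj) (subst₂ (λ u v → hasCell d' u v ≡ false) (sym (toℕ-fromℕ< il)) (sym (toℕ-fromℕ< jl)) m')

  tileOf-head : ∀ d rest i j → hasCell d i j ≡ true → tileOf (d ∷ rest) i j ≡ region d
  tileOf-head d rest i j m rewrite m = refl

  mutual
    separated-completions : ∀ b r x o → x + r ≡ n → AllPairs (Separated x o) (completions b r x o)
    separated-completions b zero x o e = [] ∷ []
    separated-completions b (suc r) x o e = separated-fillColumn b r x o rows e

    separated-fillColumn : ∀ b r x o js → x + suc r ≡ n → AllPairs (Separated x o) (fillColumn b r x o js)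
    separated-fillColumn b r x o [] e = separated-nextColumn b r x o e
    separated-fillColumn b r x o (j ∷ js) e = go (filled o 0 j) refl
      where
      go : ∀ t → filled o 0 j ≡ t → AllPairs (Separated x o) (if t then fillColumn b r x o js else concatMap (branch b r x o js) (candidates o j))
      go true _ = separated-fillColumn b r x o js e
      go false oc = separated-branches b r x o j js e oc

    separated-branches : ∀ b r x o j js → x + suc r ≡ n → filled o 0 j ≡ false → AllPairs (Separated x o) (concatMap (branch b r x o js) (candidates o j))
    -- Two branches differ in the tile covering the first free cell (x , j), and two
    -- distinct candidates are told apart by a cell that one covers and the other does not.
    separated-branches b r x o j js e oc = allPairs-concatMap (branch b r x o js) (candidates o j) separated-within (separated-across (candidates o j) (λ c m → m) (candidatesIn-distinguishable o j allChoices allChoices-distinguishable))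
      where
      tileOf-tail : ∀ c rest rest' i j' → hasCell (atColumn x c) i j' ≡ false → tileOf (atColumn x c ∷ rest) i j' ≡ tileOf (atColumn x c ∷ rest') i j' → tileOf rest i j' ≡ tileOf rest' i j'
      tileOf-tail c rest rest' i j' f eq rewrite f = eq
      separated-within : ∀ c → c ∈ candidates o j → AllPairs (Separated x o) (branch b r x o js c)
      separated-within c _ = byFit (fitsWithin r c)
        where
        byFit : ∀ t → AllPairs (Separated x o) (if t then map (atColumn x c ∷_) (fillColumn b r x (place o c) js) else [])
        byFit true = AllPairs.map⁺ (AllPairs.map (λ {rest} {rest'} (i , j' , il , jl , u , ne) →
                      i , j' , il , jl , proj₁ (∨-false⁻ (trans (sym (covered-place x o c i j' jl)) u)) ,
                      λ eq → ne (tileOf-tail c rest rest' i j' (proj₂ (∨-false⁻ (trans (sym (covered-place x o c i j' jl)) u))) eq))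
                   (separated-fillColumn b r x (place o c) js e))
        byFit false = []
      heads-separated : ∀ or Y or' Y' → (or , Y) ∈ candidates o j → (or' , Y') ∈ candidates o j → Distinguishable (or , Y) (or' , Y') → ∀ {u v} →
              (fitsWithin r (or , Y) ≡ true) × (∃ λ rest → (rest ∈ fillColumn b r x (place o (or , Y)) js) × (u ≡ atColumn x (or , Y) ∷ rest)) →
              (fitsWithin r (or' , Y') ≡ true) × (∃ λ rest → (rest ∈ fillColumn b r x (place o (or' , Y')) js) × (v ≡ atColumn x (or' , Y') ∷ rest)) →
              Separated x o u v
      heads-separated or Y or' Y' c∈ c'∈ (p , q , ip , iq) (f1 , rest , _ , refl) (f2 , rest' , _ , refl) = x + 0 , j , x<n , jl , trans (covered-+ x o 0 j) oc , neq
          where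
          parts = canPlace⁻ o j or Y (∈-candidatesIn⇒canPlace o j allChoices (or , Y) c∈)
          parts' = canPlace⁻ o j or' Y' (∈-candidatesIn⇒canPlace o j allChoices (or' , Y') c'∈)
          d = atColumn x (or , Y)
          d' = atColumn x (or' , Y')
          fd : Fits n d
          fd = subst (x + width or ≤_) e (ℕₚ.+-monoʳ-≤ x (m≤ᵇn⇒m≤n (width or) (suc r) f1)) , proj₁ parts
          x<n : x + 0 < n
          x<n = subst (_< n) (sym (ℕₚ.+-identityʳ x)) (subst (x <_) e (ℕₚ.m<m+n x (s≤s z≤n)))
          m0 : hasCell d (x + 0) j ≡ true
          m0 = trans (hasCell-+ˣ or x Y 0 j) (proj₁ (proj₂ parts))
          m0' : hasCell d' (x + 0) j ≡ true
          m0' = trans (hasCell-+ˣ or' x Y' 0 j) (proj₁ (proj₂ parts'))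
          jl : j < 4
          jl = proj₂ (hasCell⇒inRect n d (x + 0) j fd m0)
          mp : hasCell d (x + p) q ≡ true
          mp = trans (hasCell-+ˣ or x Y p q) ip
          mp' : hasCell d' (x + p) q ≡ false
          mp' = trans (hasCell-+ˣ or' x Y' p q) iq
          inp = hasCell⇒inRect n d (x + p) q fd mp
          neq : tileOf (d ∷ rest) (x + 0) j ≢ tileOf (d' ∷ rest') (x + 0) j
          neq eq = region-≢ d d' (x + p) q (proj₁ inp) (proj₂ inp) mp mp'
                     (trans (sym (tileOf-head d rest (x + 0) j m0)) (trans eq (tileOf-head d' rest' (x + 0) j m0')))
      separated-across : ∀ cs → (∀ c → c ∈ cs → c ∈ candidates o j) → AllPairs Distinguishable cs →
              AllPairs (λ c c' → ∀ {u v} → u ∈ branch b r x o js c → v ∈ branch b r x o js c' → Separated x o u v) cs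
      separated-across [] _ [] = []
      separated-across ((or , Y) ∷ cs) sub (a ∷ ap) = All.tabulate (λ {c'} c'∈ → branches-separated c' (sub c' (there c'∈)) (All.lookup a c'∈)) ∷ separated-across cs (λ c' m → sub c' (there m)) ap
        where
        branches-separated : ∀ c' → c' ∈ candidates o j → Distinguishable (or , Y) c' → ∀ {u v} → u ∈ branch b r x o js (or , Y) → v ∈ branch b r x o js c' → Separated x o u v
        branches-separated (or' , Y') c'∈ dist {u} {v} um vm = heads-separated or Y or' Y' (sub (or , Y) (here refl)) c'∈ dist
          (∈-branch⁻ b r x o js (or , Y) u um) (∈-branch⁻ b r x o js (or' , Y') v vm)

    separated-nextColumn : ∀ b r x o → x + suc r ≡ n → AllPairs (Separated x o) (nextColumn b r x o)
    separated-nextColumn b r x o e with isEmptyWindow (advance o) ∧ isSuc r ∧ b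
    ... | true = []
    ... | false = AllPairs.map (λ (i , j , il , jl , u , ne) → i , j , il , jl , covered-advance-false x o i j u , ne)
                    (separated-completions b r (suc x) (advance o) (trans (sym (ℕₚ.+-suc x r)) e))

  tileMap-injective : ∀ b → AllPairs (λ ds ds' → tileMap ds ≢ tileMap ds') (completions b n 0 emptyWindow)
  tileMap-injective b = AllPairs.map (λ {ds} {ds'} (i , j , il , jl , u , ne) eq → ne (trans (sym (tl {ds} il jl)) (trans (cong (λ m → tileAt m (fromℕ< il) (fromℕ< {m = j} {n = 4} jl)) eq) (tl {ds'} il jl))))
             (separated-completions b n 0 emptyWindow refl)
    where
    tl : ∀ {ds i j} (il : i < n) (jl : j < 4) → tileAt (tileMap ds) (fromℕ< il) (fromℕ< {m = j} {n = 4} jl) ≡ tileOf ds i j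
    tl {ds} {i} {j} il jl = trans (tileAt-tileMap ds _ _) (cong₂ (tileOf ds) (toℕ-fromℕ< il) (toℕ-fromℕ< jl))

-- Completeness: every tiling is a leaf

isEmptyColumn⇒unfilled : ∀ (c : Column) → isEmptyColumn c ≡ true → ∀ j → lookupOr false c j ≡ false
isEmptyColumn⇒unfilled (false ∷ false ∷ false ∷ false ∷ []) e j = lookupOr-emptyColumn j

isEmptyWindow⇒unfilled : ∀ o → isEmptyWindow o ≡ true → ∀ k j → filled o k j ≡ false
isEmptyWindow⇒unfilled (c0 ∷ c1 ∷ c2 ∷ []) e 0 j = isEmptyColumn⇒unfilled c0 (proj₁ (∧-true⁻ {isEmptyColumn c0} e)) j
isEmptyWindow⇒unfilled (c0 ∷ c1 ∷ c2 ∷ []) e 1 j = isEmptyColumn⇒unfilled c1 (proj₁ (∧-true⁻ {isEmptyColumn c1} {isEmptyColumn c2} (proj₂ (∧-true⁻ {isEmptyColumn c0} e)))) j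
isEmptyWindow⇒unfilled (c0 ∷ c1 ∷ c2 ∷ []) e 2 j = isEmptyColumn⇒unfilled c2 (proj₂ (∧-true⁻ {isEmptyColumn c1} {isEmptyColumn c2} (proj₂ (∧-true⁻ {isEmptyColumn c0} e)))) j
isEmptyWindow⇒unfilled (c0 ∷ c1 ∷ c2 ∷ []) e (suc (suc (suc k))) j = lookupOr-emptyColumn j

covered⇒< : ∀ y o i j → (∀ k j → filled o k j ≡ false) → covered y o i j ≡ true → i < y
covered⇒< y o i j h e with below-or-offset y i
... | inj₁ lt = lt
... | inj₂ (k , refl) = ⊥-elim (true≢false (trans (sym e) (trans (covered-+ y o k j) (h k j))))

≤⇒uncovered : ∀ y o i j → (∀ k j → filled o k j ≡ false) → y ≤ i → covered y o i j ≡ false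
≤⇒uncovered y o i j h le with below-or-offset y i
... | inj₁ lt = ⊥-elim (ℕₚ.<⇒≱ lt le)
... | inj₂ (k , refl) = trans (covered-+ y o k j) (h k j)

unfilled⇒allFree : ∀ o l → (∀ k j → (k , j) ∈ l → filled o k j ≡ false) → allFree o l ≡ true
unfilled⇒allFree o [] h = refl
unfilled⇒allFree o ((k , j) ∷ l) h rewrite h k j (here refl) = unfilled⇒allFree o l (λ k' j' m → h k' j' (there m))

∈-allChoices : ∀ or Y → Y < 4 → (or , Y) ∈ allChoices
∈-allChoices up 0 _ = here refl
∈-allChoices up 1 _ = there (here refl)
∈-allChoices up 2 _ = there (there (here refl))
∈-allChoices up 3 _ = there (there (there (here refl)))
∈-allChoices down 0 _ = there (there (there (there (here refl))))
∈-allChoices down 1 _ = there (there (there (there (there (here refl)))))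
∈-allChoices down 2 _ = there (there (there (there (there (there (here refl))))))
∈-allChoices down 3 _ = there (there (there (there (there (there (there (here refl)))))))
∈-allChoices right 0 _ = there (there (there (there (there (there (there (there (here refl))))))))
∈-allChoices right 1 _ = there (there (there (there (there (there (there (there (there (here refl)))))))))
∈-allChoices right 2 _ = there (there (there (there (there (there (there (there (there (there (here refl))))))))))
∈-allChoices right 3 _ = there (there (there (there (there (there (there (there (there (there (there (here refl)))))))))))
∈-allChoices left 0 _ = there (there (there (there (there (there (there (there (there (there (there (there (here refl))))))))))))
∈-allChoices left 1 _ = there (there (there (there (there (there (there (there (there (there (there (there (there (here refl)))))))))))))
∈-allChoices left 2 _ = there (there (there (there (there (there (there (there (there (there (there (there (there (there (here refl))))))))))))))
∈-allChoices left 3 _ = there (there (there (there (there (there (there (there (there (there (there (there (there (there (there (here refl)))))))))))))))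
∈-allChoices or (suc (suc (suc (suc Y)))) (s≤s (s≤s (s≤s (s≤s ()))))

module Completeness (n : ℕ) (m : TileMap n) (til : IsTiling n m) where
  open Soundness n

  Agrees : Placement → Set
  Agrees d = ∀ (i : Fin n) (j : Fin 4) → hasCell d (toℕ i) (toℕ j) ≡ true → tileAt m i j ≡ region d

  AllCovered : ℕ → Window → Placement → Set
  AllCovered x o d = ∀ (i' : Fin n) (j' : Fin 4) → hasCell d (toℕ i') (toℕ j') ≡ true → covered x o (toℕ i') (toℕ j') ≡ true

  Invariant : ℕ → Window → Set
  Invariant x o = ∀ (i : Fin n) (j : Fin 4) → covered x o (toℕ i) (toℕ j) ≡ true →
    ∃ λ d → (hasCell d (toℕ i) (toℕ j) ≡ true) × Agrees d × AllCovered x o d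

  tilePlacement : ∀ (i : Fin n) (j : Fin 4) → ∃ λ d → Fits n d × (tileAt m i j ≡ region d) × Agrees d
  tilePlacement i j = d , fits , teq , good
    where
    decoded = isTCopy⇒region (proj₁ (proj₂ (til i j)))
    d = proj₁ decoded
    fits = proj₁ (proj₂ decoded)
    teq = proj₂ (proj₂ decoded)
    good : Agrees d
    good i′ j′ e = trans (proj₂ (proj₂ (til i j)) i′ j′ (subst (λ R → R ∋ (i′ , j′)) (sym teq) (trans (lookup-region d i′ j′) e))) teq

  fin : ∀ {i} → i < n → Fin n
  fin p = fromℕ< p

  fin4 : ∀ {j} → j < 4 → Fin 4
  fin4 {j} p = fromℕ< {m = j} {n = 4} p

  firstFree-uncovered : ∀ x o j (xl : x < n) (jl : j < 4) → Invariant x o → covered x o x j ≡ false →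
    ∀ d → tileAt m (fin xl) (fin4 jl) ≡ region d → ∀ i' j' → Fits n d → hasCell d i' j' ≡ true → covered x o i' j' ≡ false
  firstFree-uncovered x o j xl jl inv c0 d teq i' j' f mm with covered x o i' j' in ec
  ... | false = refl
  ... | true = ⊥-elim (true≢false (trans (sym covc0) c0))
    where
    inr = hasCell⇒inRect n d i' j' f mm
    gi = fin (proj₁ inr)
    gj = fin4 (proj₂ inr)
    gie : toℕ gi ≡ i'
    gie = toℕ-fromℕ< (proj₁ inr)
    gje : toℕ gj ≡ j'
    gje = toℕ-fromℕ< (proj₂ inr)
    I = inv gi gj (subst₂ (λ u v → covered x o u v ≡ true) (sym gie) (sym gje) ec)
    d' = proj₁ I
    g' = proj₁ (proj₂ (proj₂ I))
    ac' = proj₂ (proj₂ (proj₂ I))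
    m' = proj₁ (proj₂ I)
    ti = toℕ-fromℕ< xl
    tj = toℕ-fromℕ< jl
    inT0 : tileAt m (fin xl) (fin4 jl) ∋ (gi , gj)
    inT0 = subst (λ Rg → Rg ∋ (gi , gj)) (sym teq) (trans (lookup-region d gi gj) (subst₂ (λ u v → hasCell d u v ≡ true) (sym gie) (sym gje) mm))
    eqd' : region d' ≡ tileAt m (fin xl) (fin4 jl)
    eqd' = trans (sym (g' gi gj m')) (proj₂ (proj₂ (til (fin xl) (fin4 jl))) gi gj inT0)
    c0in : hasCell d' (toℕ (fin xl)) (toℕ (fin4 jl)) ≡ true
    c0in = trans (sym (lookup-region d' (fin xl) (fin4 jl))) (subst (λ Rg → Rg ∋ (fin xl , fin4 jl)) (sym eqd') (proj₁ (til (fin xl) (fin4 jl))))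
    covc0 : covered x o x j ≡ true
    covc0 = subst₂ (λ u v → covered x o u v ≡ true) ti tj (ac' (fin xl) (fin4 jl) c0in)

  ∧₃-true⁺ : ∀ {a b c} → a ≡ true → b ≡ true → c ≡ true → (a ∧ b ∧ c) ≡ true
  ∧₃-true⁺ refl refl refl = refl

  0<height : ∀ or → 0 < height or
  0<height up = s≤s z≤n
  0<height down = s≤s z≤n
  0<height right = s≤s z≤n
  0<height left = s≤s z≤n

  rows<4 : All (_< 4) rows
  rows<4 = s≤s z≤n ∷ s≤s (s≤s z≤n) ∷ s≤s (s≤s (s≤s z≤n)) ∷ s≤s (s≤s (s≤s (s≤s z≤n))) ∷ []

  freeRowsIn-[] : ∀ o → FreeRowsIn o [] → FirstColumnFull o
  freeRowsIn-[] o fe j jl with filled o 0 j in oc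
  ... | true = refl
  ... | false with fe j jl oc
  ... | ()

  x<n : ∀ {x r} → x + suc r ≡ n → x < n
  x<n {x} {r} e = subst (x <_) e (ℕₚ.m<m+n x (s≤s z≤n))

  mutual
    complete-completion : ∀ b r x o → x + r ≡ n → Invariant x o → (b ≡ true → FaultFree m) → ∃ λ ds → Completion b r x o ds × All Agrees ds
    complete-completion b zero x o e inv ff = [] , finished , []
    complete-completion b (suc r) x o e inv ff with complete-fillColumn b r x o rows e inv (freeRowsIn-rows o) rows<4 ff
    ... | ds , p , g = ds , startColumn p , g

    complete-fillColumn : ∀ b r x o js → x + suc r ≡ n → Invariant x o → FreeRowsIn o js → All (_< 4) js → (b ≡ true → FaultFree m) →
            ∃ λ ds → FillColumn b r x o js ds × All Agrees ds
    complete-fillColumn b r x o [] e inv fe _ ff with complete-nextColumn b r x o e inv (freeRowsIn-[] o fe) ff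
    ... | ds , p , g = ds , columnDone p , g
    complete-fillColumn b r x o (j ∷ js) e inv fe (jl ∷ jsl) ff with filled o 0 j in oc
    ... | true with complete-fillColumn b r x o js e inv freeRows′ jsl ff
      where
      freeRows′ : FreeRowsIn o js
      freeRows′ j' jl' f with fe j' jl' f
      ... | here refl = ⊥-elim (true≢false (trans (sym oc) f))
      ... | there mm = mm
    ... | ds , p , g = ds , skipFilled oc p , g
    complete-fillColumn b r x o (j ∷ js) e inv fe (jl ∷ jsl) ff | false = coverFirstFree b r x o j js e inv fe jl jsl ff oc

    coverFirstFree : ∀ b r x o j js → x + suc r ≡ n → Invariant x o → FreeRowsIn o (j ∷ js) → j < 4 → All (_< 4) js →
               (b ≡ true → FaultFree m) → filled o 0 j ≡ false → ∃ λ ds → FillColumn b r x o (j ∷ js) ds × All Agrees ds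
    coverFirstFree b r x o j js e inv fe jl jsl ff oc =
      let ((or , X , Y) , f , teq , good) = tilePlacement (fin (x<n e)) (fin4 jl)
      in coverFirstFree′ b r x o j js e inv fe jl jsl ff oc or X Y f teq good

    coverFirstFree′ : ∀ b r x o j js → (e : x + suc r ≡ n) → Invariant x o → FreeRowsIn o (j ∷ js) → (jl : j < 4) → All (_< 4) js →
               (b ≡ true → FaultFree m) → filled o 0 j ≡ false → ∀ or X Y → Fits n (or , X , Y) →
               tileAt m (fin (x<n e)) (fin4 jl) ≡ region (or , X , Y) → Agrees (or , X , Y) →
               ∃ λ ds → FillColumn b r x o (j ∷ js) ds × All Agrees ds
    coverFirstFree′ b r x o j js e inv fe jl jsl ff oc or X Y f teq good with ℕₚ.≤∧≮⇒≡ (hasCell⇒X≤i or X Y x j memc0) notlt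
      where
      xl = x<n e
      c0free : covered x o x j ≡ false
      c0free = trans (cong (λ z → covered x o z j) (sym (ℕₚ.+-identityʳ x))) (trans (covered-+ x o 0 j) oc)
      memc0 : hasCell (or , X , Y) x j ≡ true
      memc0 = subst₂ (λ u v → hasCell (or , X , Y) u v ≡ true) (toℕ-fromℕ< xl) (toℕ-fromℕ< jl)
               (trans (sym (lookup-region (or , X , Y) (fin xl) (fin4 jl))) (subst (λ Rg → Rg ∋ (fin xl , fin4 jl)) teq (proj₁ (til (fin xl) (fin4 jl)))))
      notlt : ¬ (X < x)
      notlt lt with hasCell-firstColumn or X Y
      ... | q , mq = true≢false (trans (sym (covered-< x o X (Y + q) lt)) (firstFree-uncovered x o j xl jl inv c0free (or , X , Y) teq X (Y + q) f mq))
    ... | refl = (atColumn x c ∷ ds) , placeTile c oc c∈ ef p , good ∷ g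
      where
      xl = x<n e
      c = (or , Y)
      d = (or , x , Y)
      c0free : covered x o x j ≡ false
      c0free = trans (cong (λ z → covered x o z j) (sym (ℕₚ.+-identityʳ x))) (trans (covered-+ x o 0 j) oc)
      memc0 : hasCell d x j ≡ true
      memc0 = subst₂ (λ u v → hasCell d u v ≡ true) (toℕ-fromℕ< xl) (toℕ-fromℕ< jl)
               (trans (sym (lookup-region d (fin xl) (fin4 jl))) (subst (λ Rg → Rg ∋ (fin xl , fin4 jl)) teq (proj₁ (til (fin xl) (fin4 jl)))))
      unc = firstFree-uncovered x o j xl jl inv c0free d teq
      v2 : hasCell (or , 0 , Y) 0 j ≡ true
      v2 = trans (sym (hasCell-+ˣ or x Y 0 j)) (trans (cong (λ z → hasCell d z j) (ℕₚ.+-identityʳ x)) memc0)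
      v3 : allFree o (cells (or , 0 , Y)) ≡ true
      v3 = unfilled⇒allFree o _ (λ k j' km → trans (sym (covered-+ x o k j'))
             (unc (x + k) j' f (trans (hasCell-+ˣ or x Y k j') (Equivalence.from (hasCell⇔ (or , 0 , Y) k j') km))))
      vd : canPlace o j c ≡ true
      vd = ∧₃-true⁺ (m≤n⇒m≤ᵇn (Y + height or) 4 (proj₂ f)) v2 v3
      c∈ : c ∈ candidates o j
      c∈ = canPlace⇒∈-candidatesIn o j allChoices c (∈-allChoices or Y (ℕₚ.<-≤-trans (ℕₚ.m<m+n Y (0<height or)) (proj₂ f))) vd
      ef : fitsWithin r c ≡ true
      ef = m≤n⇒m≤ᵇn (width or) (suc r) (ℕₚ.+-cancelˡ-≤ x (width or) (suc r) (subst (x + width or ≤_) (sym e) (proj₁ f)))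
      freeRows′ : FreeRowsIn (place o c) js
      freeRows′ j' jl' fz with ∨-false⁻ (trans (sym (filled-place o c 0 j' jl')) fz)
      ... | f1 , f2 with fe j' jl' f1
      ... | here refl = ⊥-elim (true≢false (trans (sym v2) f2))
      ... | there mm = mm
      invariant′ : Invariant x (place o c)
      invariant′ i j' cv with ∨-true⁻ (trans (sym (covered-place x o c (toℕ i) (toℕ j') (toℕ<n j'))) cv)
      ... | inj₁ old with inv i j' old
      ... | d' , m' , g' , ac' = d' , m' , g' , λ i'' j'' mm → trans (covered-place x o c (toℕ i'') (toℕ j'') (toℕ<n j'')) (cong (_∨ hasCell d (toℕ i'') (toℕ j'')) (ac' i'' j'' mm))
      invariant′ i j' cv | inj₂ md = d , md , good , λ i'' j'' mm → trans (covered-place x o c (toℕ i'') (toℕ j'') (toℕ<n j'')) (trans (cong (covered x o (toℕ i'') (toℕ j'') ∨_) mm) (∨-zeroʳ _))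
      rec = complete-fillColumn b r x (place o c) js e invariant′ freeRows′ jsl ff
      ds = proj₁ rec
      p = proj₁ (proj₂ rec)
      g = proj₂ (proj₂ rec)

    complete-nextColumn : ∀ b r x o → x + suc r ≡ n → Invariant x o → FirstColumnFull o → (b ≡ true → FaultFree m) → ∃ λ ds → NextColumn b r x o ds × All Agrees ds
    complete-nextColumn b r x o e inv full ff with isEmptyWindow (advance o) ∧ isSuc r ∧ b in ec
    ... | false with complete-completion b r (suc x) (advance o) (trans (sym (ℕₚ.+-suc x r)) e) invariant′ ff
      where
      cs : ∀ (i : Fin n) (j : Fin 4) → covered (suc x) (advance o) (toℕ i) (toℕ j) ≡ covered x o (toℕ i) (toℕ j)
      cs i j = covered-advance x o full (toℕ i) (toℕ j) (toℕ<n j)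
      invariant′ : Invariant (suc x) (advance o)
      invariant′ i j cv with inv i j (trans (sym (cs i j)) cv)
      ... | d' , m' , g' , ac' = d' , m' , g' , λ i' j' mm → trans (cs i' j') (ac' i' j' mm)
    ... | ds , p , g = ds , moveOn ec p , g
    complete-nextColumn b r x o e inv full ff | true = ⊥-elim (noFaultAhead b r x o e inv full ff ec)

    noFaultAhead : ∀ b r x o → x + suc r ≡ n → Invariant x o → FirstColumnFull o → (b ≡ true → FaultFree m) → (isEmptyWindow (advance o) ∧ isSuc r ∧ b) ≡ true → ⊥
    noFaultAhead b zero x o e inv full ff ec with ∧-true⁻ {isEmptyWindow (advance o)} ec
    ... | _ , ()
    noFaultAhead b (suc r') x o e inv full ff ec with ∧-true⁻ {isEmptyWindow (advance o)} ec
    ... | e1 , bt = ff bt (suc x , s≤s z≤n , sxn , fault)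
      where
      sxn : suc x < n
      sxn = subst (suc x <_) e (subst (suc x <_) (sym (ℕₚ.+-suc x (suc r'))) (s≤s (subst (x <_) (sym (ℕₚ.+-suc x r')) (s≤s (ℕₚ.m≤m+n x r')))))
      emp = isEmptyWindow⇒unfilled (advance o) e1
      cs : ∀ i j → j < 4 → covered (suc x) (advance o) i j ≡ covered x o i j
      cs i j jl = covered-advance x o full i j jl
      fault : FaultAt m (suc x)
      fault i j with ℕₚ.<-≤-connex (toℕ i) (suc x)
      ... | inj₁ lt with inv i j (trans (sym (cs (toℕ i) (toℕ j) (toℕ<n j))) (covered-< (suc x) (advance o) (toℕ i) (toℕ j) lt))
      ... | d' , m' , g' , ac' = inj₁ (λ i' j' mm → covered⇒< (suc x) (advance o) (toℕ i') (toℕ j') emp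
                 (trans (cs (toℕ i') (toℕ j') (toℕ<n j')) (ac' i' j' (region-∋⇒hasCell d' i' j' (subst (λ Rg → Rg ∋ (i' , j')) (g' i j m') mm)))))
      fault i j | inj₂ le = inj₂ rt
        where
        rt : ∀ i' j' → tileAt m i j ∋ (i' , j') → suc x ≤ toℕ i'
        rt i' j' mm with ℕₚ.<-≤-connex (toℕ i') (suc x)
        ... | inj₂ le' = le'
        ... | inj₁ lt' with inv i' j' (trans (sym (cs (toℕ i') (toℕ j') (toℕ<n j'))) (covered-< (suc x) (advance o) (toℕ i') (toℕ j') lt'))
        ... | d'' , m'' , g'' , ac'' = ⊥-elim (true≢false (trans (sym covij) (≤⇒uncovered (suc x) (advance o) (toℕ i) (toℕ j) emp le)))
          where
          eqT : tileAt m i j ≡ region d''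
          eqT = trans (sym (proj₂ (proj₂ (til i j)) i' j' mm)) (g'' i' j' m'')
          covij : covered (suc x) (advance o) (toℕ i) (toℕ j) ≡ true
          covij = trans (cs (toℕ i) (toℕ j) (toℕ<n j)) (ac'' i j (region-∋⇒hasCell d'' i j (subst (λ Rg → Rg ∋ (i , j)) eqT (proj₁ (til i j)))))

  invariant-emptyWindow : Invariant 0 emptyWindow
  invariant-emptyWindow i j cv = ⊥-elim (true≢false (trans (sym cv) (covered-emptyWindow (toℕ i) (toℕ j))))

  completions-complete : ∀ b → (b ≡ true → FaultFree m) → ∃ λ ds → (ds ∈ completions b n 0 emptyWindow) × (m ≡ tileMap ds)
  completions-complete b ff with complete-completion b n 0 emptyWindow refl invariant-emptyWindow ff
  ... | ds , p , g = ds , ∈-completions⁺ p , vec-ext (λ i → vec-ext (λ j → eqc i j))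
    where
    S = Soundness.sound-completion n refl p
    eqc : ∀ i j → tileAt m i j ≡ tileAt (tileMap ds) i j
    eqc i j with find (Sound.coverAll S (toℕ i) (toℕ j) (toℕ<n i) (toℕ<n j) (covered-emptyWindow (toℕ i) (toℕ j)))
    ... | d , d∈ , mm = trans (All.lookup g d∈ i j mm) (sym (trans (tileAt-tileMap ds i j) (tileOf-∈ ds (toℕ i) (toℕ j) (Sound.disjoint S) d∈ mm)))

tilings-hasCount : ∀ b n → HasCount (λ m → IsTiling n m × (b ≡ true → FaultFree m)) (#tilings b n)
tilings-hasCount b n = map tileMap (completions b n 0 emptyWindow) ,
  trans (length-map tileMap (completions b n 0 emptyWindow)) (length-completions b n 0 emptyWindow) ,
  AllPairs.map⁺ (tileMap-injective b) ,
  All.map⁺ (All.tabulate λ {ds} ds∈ → sound (sound-completion refl (∈-completions⁻ b n 0 emptyWindow ds ds∈))) ,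
  λ m (tiling , faultFree) → let (ds , ds∈ , m≡ds) = Completeness.completions-complete n m tiling b faultFree
                             in subst (_∈ _) (sym m≡ds) (∈-map⁺ tileMap ds∈)
  where
  open Soundness n
  open Injectivity n using (tileMap-injective)
  sound : ∀ {ds} → Sound b 0 emptyWindow ds → IsTiling n (tileMap ds) × (b ≡ true → FaultFree (tileMap ds))
  sound S = tileMap-isTiling S , λ { refl → tileMap-faultFree S }

mainTheorem7 : (∀ (n : ℕ) → 1 ≤ n → Tileable n → 4 ∣ n)
    × (∀ (t : ℕ) → HasCount (IsTiling (4 * t)) (Nclosed t))
    × (∀ (t : ℕ) → 1 ≤ t → HasCount (λ m → IsTiling (4 * t) m × FaultFree m) 2)
mainTheorem7 = divisibility , count , faultFreeCount
  where
  divisibility : ∀ n → 1 ≤ n → Tileable n → 4 ∣ n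
  divisibility n _ (m , tiling) with 4∣n⊎#tilings≡0 n
  ... | inj₁ 4∣n = 4∣n
  ... | inj₂ none = ⊥-elim (hasCount-zero {a = m} (subst (HasCount _) none (tilings-hasCount false n)) (tiling , λ ()))

  count : ∀ t → HasCount (IsTiling (4 * t)) (Nclosed t)
  count t = subst (HasCount _) (#tilings≡Nclosed t)
    (hasCount-resp (λ m → mk⇔ proj₁ (_, λ ())) (tilings-hasCount false (4 * t)))

  faultFreeCount : ∀ t → 1 ≤ t → HasCount (λ m → IsTiling (4 * t) m × FaultFree m) 2
  faultFreeCount t t≥1 = subst (HasCount _) (#faultFree≡2 t t≥1)
    (hasCount-resp (λ m → mk⇔ (λ (tiling , ff) → tiling , ff refl) (λ (tiling , ff) → tiling , λ _ → ff))
      (tilings-hasCount true (4 * t)))
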